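{- Let $n\ge m\ge 2$. Then $$\mu_{\rm d}(P_n\,\square\,P_m)=\begin{cases}3, & n=m=2,\\ 4, & (n,m)=(3,3)\ \text{or}\ (n\ge 3\ \text{and}\ m=2),\\ 5, & \text{otherwise}.\end{cases}$$
   Context: The grid graph $P_n\,\square\,P_m$ has vertex set $[n]\times[m]$, with $(i,j)$ adjacent to $(k,\ell)$ iff $|i-k|+|j-\ell|=1$. For a graph $G$ and $X\subseteq V(G)$, vertices $u,v\in V(G)$ are $X$-visible if there exists a shortest $u,v$-path $P$ with $V(P)\cap X\subseteq\{u,v\}$. $X$ is a dual mutual-visibility set if every two vertices of $X$ are $X$-visible and every two vertices of $V(G)\setminus X$ are $X$-visible; $\mu_{\rm d}(G)$ is the maximum cardinality of a dual mutual-visibility set of $G$. -}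

module Defs where

open import Data.Nat using (ℕ; zero; suc; _≤_; ∣_-_∣; _+_)
open import Data.Fin using (Fin; toℕ)
open import Data.Fin.Base using () 
open import Data.Bool using (Bool; true; false)
open import Data.List using (List; []; _∷_; length; filter; cartesianProduct; allFin)
open import Data.List.Membership.Propositional using (_∈_)
open import Data.Product using (_×_; _,_; ∃; Σ)
open import Data.Sum using (_⊎_)
open import Relation.Binary.PropositionalEquality using (_≡_)
open import Relation.Nullary using (¬_)
open import Data.Bool using (T)
open import Relation.Nullary.Decidable using (does)
open import Data.Bool.Properties using (T?)

-- Vertices of the grid P_n □ P_m : [n] × [m], here indexed from 0 via Fin.
Vertex : ℕ → ℕ → Set
Vertex n m = Fin n × Fin m

Adj : ∀ {n m} → Vertex n m → Vertex n m → Set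
Adj (i , j) (k , l) = ∣ toℕ i - toℕ k ∣ + ∣ toℕ j - toℕ l ∣ ≡ 1

data Walk {n m : ℕ} : Vertex n m → Vertex n m → Set where
  [] : ∀ {u} → Walk u u
  _∷_ : ∀ {u w v} → Adj u w → Walk w v → Walk u v

walkLength : ∀ {n m} {u v : Vertex n m} → Walk u v → ℕ
walkLength [] = 0
walkLength (_ ∷ p) = suc (walkLength p)

walkVertices : ∀ {n m} {u v : Vertex n m} → Walk u v → List (Vertex n m)
walkVertices {u = u} [] = u ∷ []
walkVertices {u = u} (_ ∷ p) = u ∷ walkVertices p

-- A shortest u,v-path: a u,v-walk of length at most that of every u,v-walk
-- (such a walk is necessarily a path).
IsShortest : ∀ {n m} {u v : Vertex n m} → Walk u v → Set
IsShortest {u = u} {v = v} p = ∀ (q : Walk u v) → walkLength p ≤ walkLength q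

VSubset : ℕ → ℕ → Set
VSubset n m = Vertex n m → Bool

_∈S_ : ∀ {n m} → Vertex n m → VSubset n m → Set
v ∈S X = X v ≡ true

_∉S_ : ∀ {n m} → Vertex n m → VSubset n m → Set
v ∉S X = X v ≡ false

Visible : ∀ {n m} → VSubset n m → Vertex n m → Vertex n m → Set
Visible X u v =
  Σ (Walk u v) λ P → IsShortest P ×
    (∀ w → w ∈ walkVertices P → w ∈S X → (w ≡ u) ⊎ (w ≡ v))

IsDualMV : ∀ {n m} → VSubset n m → Set
IsDualMV X =
  (∀ u v → u ∈S X → v ∈S X → Visible X u v) ×
  (∀ u v → u ∉S X → v ∉S X → Visible X u v)

allVertices : (n m : ℕ) → List (Vertex n m)
allVertices n m = cartesianProduct (allFin n) (allFin m)

card : ∀ {n m} → VSubset n m → ℕ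
card {n} {m} X = length (filter (λ v → T? (X v)) (allVertices n m))

MuD≡ : ℕ → ℕ → ℕ → Set
MuD≡ n m k =
  (Σ (VSubset n m) λ X → IsDualMV X × card X ≡ k) ×
  (∀ (X : VSubset n m) → IsDualMV X → card X ≤ k)

-- In a dual mutual-visibility set X every geodesic between two vertices of a line
-- runs along the line, so if a vertex of X lies strictly between two vertices of a line, exactly
-- one of those two is in X. For a vertex of X with two vertices of its line on each side these
-- constraints contradict each other, so X meets only the rows 0, 1, n-2, n-1 and the
-- columns 0, 1, m-2, m-1. Moreover, if both neighbours of a corner lie in X, then X, or else its
-- complement, is confined to the corner and its neighbours. These constraints live on the grid
-- of at most 4 × 4 kept vertices, where an exhaustive search bounds |X|.
--
-- Explicit sets near the corners whose complement is convex along rows and columns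
-- and which contain no two diagonal neighbours: a greedy monotone path between free vertices can
-- then always step to a free vertex, and two vertices of X are joined through free neighbours.

module Submission where

open import Defs
open import Function using (_∘_; _⇔_; Equivalence; mk⇔)
open import Data.Nat
  using (ℕ; zero; suc; _+_; _∸_; _≤_; _<_; _≥_; s≤s; z≤n; ∣_-_∣; _≟_; _<?_; _<ᵇ_; _≤ᵇ_; _≡ᵇ_; NonZero)
open import Data.Nat.Properties
open import Data.Nat.DivMod using (_mod_; m<n⇒m%n≡m)
open import Data.Fin using (toℕ; fromℕ<)
import Data.Fin as Fin
open import Data.Fin.Properties using (toℕ-fromℕ<; toℕ-injective; toℕ<n)
open import Data.Bool using (Bool; true; false; T; _∧_; _∨_; not; _xor_; if_then_else_)
open import Data.Bool.Properties using (T?; T-≡; ∧-conicalˡ; ∧-conicalʳ; ∨-zeroʳ)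
open import Data.Product using (_×_; _,_; proj₁; proj₂; Σ-syntax)
import Data.Product as Product
open import Data.Product.Properties using (≡-dec)
open import Data.Sum using (_⊎_; inj₁; inj₂; [_,_]′)
import Data.Sum as Sum
open import Data.Empty using (⊥; ⊥-elim)
open import Data.List
  using (List; []; _∷_; _++_; length; map; concat; filter; applyUpTo; allFin; cartesianProduct)
open import Data.List.Properties using (length-map; length-applyUpTo; concat-map; length-++)
open import Data.List.Membership.Propositional using (_∈_)
open import Data.List.Membership.Propositional.Properties
  using ( ∈-∃++; ∈-map⁺; ∈-map⁻; ∈-filter⁺; ∈-filter⁻; ∈-allFin; ∈-cartesianProduct⁺
        ; ∈-applyUpTo⁺; ∈-concat⁺′)
open import Data.List.Membership.DecPropositional (≡-dec _≟_ _≟_) using (_∈?_)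
open import Data.List.Relation.Unary.All using (All; []; _∷_)
import Data.List.Relation.Unary.All as All
open import Data.List.Relation.Unary.AllPairs using (AllPairs; []; _∷_)
open import Data.List.Relation.Unary.Any using (here; there)
open import Data.List.Relation.Unary.Unique.Propositional using (Unique)
open import Data.List.Relation.Unary.Unique.Propositional.Properties
  using (allFin⁺; cartesianProduct⁺; filter⁺)
import Data.List.Relation.Unary.Unique.Propositional.Properties as Unique
open import Relation.Nullary using (¬_; yes; no; does; proof)
open import Relation.Nullary.Decidable using (dec-true; dec-false)
open import Relation.Nullary.Reflects using (Reflects; invert)
open import Relation.Binary.Definitions using (tri<; tri≈; tri>)
open import Relation.Binary.PropositionalEquality
open import Algebra.Properties.CommutativeSemigroup +-commutativeSemigroup using (interchange)

private variable
  n m : ℕ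

-- Grid distance, walks and visibility

row col : Vertex n m → ℕ
row v = toℕ (proj₁ v)
col v = toℕ (proj₂ v)

-- Adj u v unfolds to dist u v ≡ 1.
dist : Vertex n m → Vertex n m → ℕ
dist u v = ∣ row u - row v ∣ + ∣ col u - col v ∣

vertex-≡ : {u v : Vertex n m} → row u ≡ row v → col u ≡ col v → u ≡ v
vertex-≡ r≡ c≡ = cong₂ _,_ (toℕ-injective r≡) (toℕ-injective c≡)

vertex : (a b : ℕ) → a < n → b < m → Vertex n m
vertex a b a<n b<m = fromℕ< a<n , fromℕ< b<m

row-vertex : ∀ {a b} (a<n : a < n) (b<m : b < m) → row (vertex a b a<n b<m) ≡ a
row-vertex a<n b<m = toℕ-fromℕ< a<n

col-vertex : ∀ {a b} (a<n : a < n) (b<m : b < m) → col (vertex a b a<n b<m) ≡ b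
col-vertex a<n b<m = toℕ-fromℕ< b<m

row< : (v : Vertex n m) → row v < n
row< v = toℕ<n (proj₁ v)

col< : (v : Vertex n m) → col v < m
col< v = toℕ<n (proj₂ v)

dist-self : (u : Vertex n m) → dist u u ≡ 0
dist-self u = cong₂ _+_ (∣n-n∣≡0 (row u)) (∣n-n∣≡0 (col u))

dist-sym : (u v : Vertex n m) → dist u v ≡ dist v u
dist-sym u v = cong₂ _+_ (∣-∣-comm (row u) (row v)) (∣-∣-comm (col u) (col v))

dist-triangle : (u w v : Vertex n m) → dist u v ≤ dist u w + dist w v
dist-triangle u w v = begin
  dist u v
    ≤⟨ +-mono-≤ (∣-∣-triangle (row u) (row w) (row v)) (∣-∣-triangle (col u) (col w) (col v)) ⟩
  (∣ row u - row w ∣ + ∣ row w - row v ∣) + (∣ col u - col w ∣ + ∣ col w - col v ∣)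
    ≡⟨ interchange ∣ row u - row w ∣ _ _ _ ⟩
  dist u w + dist w v
    ∎
  where open ≤-Reasoning

dist≡0 : {u v : Vertex n m} → dist u v ≡ 0 → u ≡ v
dist≡0 {u = u} {v} d = vertex-≡ (∣m-n∣≡0⇒m≡n (m+n≡0⇒m≡0 _ d))
                                 (∣m-n∣≡0⇒m≡n (m+n≡0⇒n≡0 ∣ row u - row v ∣ d))

adj-sym : {u w : Vertex n m} → Adj u w → Adj w u
adj-sym {u = u} {w} u~w = trans (dist-sym w u) u~w

adj-irrefl : {u : Vertex n m} → ¬ Adj u u
adj-irrefl {u = u} u~u with trans (sym (dist-self u)) u~u
... | ()

dist≤walkLength : {u v : Vertex n m} (P : Walk u v) → dist u v ≤ walkLength P
dist≤walkLength {u = u} [] = ≤-reflexive (dist-self u)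
dist≤walkLength {u = u} {v} (_∷_ {w = w} u~w P) = begin
  dist u v            ≤⟨ dist-triangle u w v ⟩
  dist u w + dist w v ≡⟨ cong (_+ dist w v) u~w ⟩
  suc (dist w v)      ≤⟨ s≤s (dist≤walkLength P) ⟩
  suc (walkLength P)  ∎
  where open ≤-Reasoning

dist-via : {u v : Vertex n m} (P : Walk u v) {w : Vertex n m} → w ∈ walkVertices P →
           dist u w + dist w v ≤ walkLength P
dist-via {u = u} [] (here refl) rewrite dist-self u = ≤-refl
dist-via {u = u} P@(_ ∷ _) (here refl) rewrite dist-self u = dist≤walkLength P
dist-via {u = u} {v} (_∷_ {w = x} u~x P) {w} (there w∈P) = begin
  dist u w + dist w v              ≤⟨ +-monoˡ-≤ (dist w v) (dist-triangle u x w) ⟩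
  dist u x + dist x w + dist w v   ≡⟨ +-assoc (dist u x) _ _ ⟩
  dist u x + (dist x w + dist w v) ≡⟨ cong (_+ (dist x w + dist w v)) u~x ⟩
  suc (dist x w + dist w v)        ≤⟨ s≤s (dist-via P w∈P) ⟩
  suc (walkLength P)               ∎
  where open ≤-Reasoning

infixl 5 _∷ʳ_
_∷ʳ_ : {u w v : Vertex n m} → Walk u w → Adj w v → Walk u v
[] ∷ʳ w~v = w~v ∷ []
(e ∷ P) ∷ʳ w~v = e ∷ (P ∷ʳ w~v)

walkLength-∷ʳ : {u w v : Vertex n m} (P : Walk u w) (w~v : Adj w v) →
                walkLength (P ∷ʳ w~v) ≡ suc (walkLength P)
walkLength-∷ʳ [] w~v = refl
walkLength-∷ʳ (e ∷ P) w~v = cong suc (walkLength-∷ʳ P w~v)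

∈-walkVertices-∷ʳ : {u w v x : Vertex n m} (P : Walk u w) (w~v : Adj w v) →
                    x ∈ walkVertices (P ∷ʳ w~v) → x ∈ walkVertices P ⊎ x ≡ v
∈-walkVertices-∷ʳ [] w~v (here refl) = inj₁ (here refl)
∈-walkVertices-∷ʳ [] w~v (there (here refl)) = inj₂ refl
∈-walkVertices-∷ʳ (e ∷ P) w~v (here refl) = inj₁ (here refl)
∈-walkVertices-∷ʳ (e ∷ P) w~v (there x∈) = Sum.map₁ there (∈-walkVertices-∷ʳ P w~v x∈)

reverse : {u v : Vertex n m} → Walk u v → Walk v u
reverse [] = []
reverse {u = u} (_∷_ {w = w} u~w P) = reverse P ∷ʳ adj-sym {u = u} {w} u~w

walkLength-reverse : {u v : Vertex n m} (P : Walk u v) → walkLength (reverse P) ≡ walkLength P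
walkLength-reverse [] = refl
walkLength-reverse {u = u} (_∷_ {w = w} u~w P) =
  trans (walkLength-∷ʳ (reverse P) (adj-sym {u = u} {w} u~w)) (cong suc (walkLength-reverse P))

∈-walkVertices-reverse : {u v x : Vertex n m} (P : Walk u v) →
                         x ∈ walkVertices (reverse P) → x ∈ walkVertices P
∈-walkVertices-reverse [] x∈ = x∈
∈-walkVertices-reverse {u = u} (_∷_ {w = w} u~w P) x∈
  with ∈-walkVertices-∷ʳ (reverse P) (adj-sym {u = u} {w} u~w) x∈
... | inj₁ x∈P = there (∈-walkVertices-reverse P x∈P)
... | inj₂ refl = here refl

geodesic-shortest : {u v : Vertex n m} (P : Walk u v) → walkLength P ≡ dist u v → IsShortest P
geodesic-shortest P ∣P∣≡d Q = ≤-trans (≤-reflexive ∣P∣≡d) (dist≤walkLength Q)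

visible-geodesic : (X : VSubset n m) {u v : Vertex n m} (P : Walk u v) → walkLength P ≡ dist u v →
                   (∀ w → w ∈ walkVertices P → w ∈S X → w ≡ u ⊎ w ≡ v) → Visible X u v
visible-geodesic X P ∣P∣≡d avoids = P , geodesic-shortest P ∣P∣≡d , avoids

visible-refl : (X : VSubset n m) (u : Vertex n m) → Visible X u u
visible-refl X u = visible-geodesic X [] (sym (dist-self u)) λ { _ (here refl) _ → inj₁ refl }

visible-adjacent : (X : VSubset n m) {u v : Vertex n m} → Adj u v → Visible X u v
visible-adjacent X u~v = visible-geodesic X (u~v ∷ []) (sym u~v) λ where
  _ (here refl) _ → inj₁ refl
  _ (there (here refl)) _ → inj₂ refl

visible-sym : (X : VSubset n m) {u v : Vertex n m} → Visible X u v → Visible X v u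
visible-sym X (P , P-short , avoids) =
  reverse P ,
  (λ Q → begin
    walkLength (reverse P) ≡⟨ walkLength-reverse P ⟩
    walkLength P           ≤⟨ P-short (reverse Q) ⟩
    walkLength (reverse Q) ≡⟨ walkLength-reverse Q ⟩
    walkLength Q           ∎) ,
  λ w w∈ w∈X → Sum.swap (avoids w (∈-walkVertices-reverse P w∈) w∈X)
  where open ≤-Reasoning

-- Geodesics avoiding a set

∣1+n-n∣≡1 : ∀ a → ∣ suc a - a ∣ ≡ 1
∣1+n-n∣≡1 zero = refl
∣1+n-n∣≡1 (suc a) = ∣1+n-n∣≡1 a

∣n-1+n∣≡1 : ∀ a → ∣ a - suc a ∣ ≡ 1
∣n-1+n∣≡1 a = trans (∣-∣-comm a (suc a)) (∣1+n-n∣≡1 a)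

towards : ℕ → ℕ → ℕ
towards zero zero = zero
towards zero (suc b) = 1
towards (suc a) zero = a
towards (suc a) (suc b) = suc (towards a b)

∣a-towards∣≡1 : ∀ {a b} → a ≢ b → ∣ a - towards a b ∣ ≡ 1
∣a-towards∣≡1 {zero} {zero} a≢b = ⊥-elim (a≢b refl)
∣a-towards∣≡1 {zero} {suc b} a≢b = refl
∣a-towards∣≡1 {suc a} {zero} a≢b = ∣1+n-n∣≡1 a
∣a-towards∣≡1 {suc a} {suc b} a≢b = ∣a-towards∣≡1 (a≢b ∘ cong suc)

towards-closer : ∀ {a b} → a ≢ b → suc ∣ towards a b - b ∣ ≡ ∣ a - b ∣
towards-closer {zero} {zero} a≢b = ⊥-elim (a≢b refl)
towards-closer {zero} {suc b} a≢b = refl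
towards-closer {suc a} {zero} a≢b = cong suc (∣-∣-identityʳ a)
towards-closer {suc a} {suc b} a≢b = towards-closer (a≢b ∘ cong suc)

towards-< : ∀ {a b L} → a < L → b < L → towards a b < L
towards-< {zero} {zero} a<L b<L = a<L
towards-< {zero} {suc b} a<L b<L = ≤-trans (s≤s (s≤s z≤n)) b<L
towards-< {suc a} {zero} a<L b<L = <-trans (n<1+n a) a<L
towards-< {suc a} {suc b} (s≤s a<L) (s≤s b<L) = s≤s (towards-< a<L b<L)

StrictlyBetween : ℕ → ℕ → ℕ → Set
StrictlyBetween a t b = (a < t × t < b) ⊎ (b < t × t < a)

towards-reaches-or-between : ∀ a b → towards a b ≡ b ⊎ StrictlyBetween a (towards a b) b
towards-reaches-or-between zero zero = inj₁ refl
towards-reaches-or-between zero (suc zero) = inj₁ refl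
towards-reaches-or-between zero (suc (suc b)) = inj₂ (inj₁ (s≤s z≤n , s≤s (s≤s z≤n)))
towards-reaches-or-between (suc zero) zero = inj₁ refl
towards-reaches-or-between (suc (suc a)) zero = inj₂ (inj₂ (s≤s z≤n , n<1+n (suc a)))
towards-reaches-or-between (suc a) (suc b) =
  Sum.map (cong suc) (Sum.map (Product.map s≤s s≤s) (Product.map s≤s s≤s))
          (towards-reaches-or-between a b)

dist-vertexˡ : ∀ {a b} (a<n : a < n) (b<m : b < m) (v : Vertex n m) →
               dist (vertex a b a<n b<m) v ≡ ∣ a - row v ∣ + ∣ b - col v ∣
dist-vertexˡ a<n b<m v =
  cong₂ (λ a b → ∣ a - row v ∣ + ∣ b - col v ∣) (row-vertex a<n b<m) (col-vertex a<n b<m)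

dist-vertexʳ : ∀ {a b} (u : Vertex n m) (a<n : a < n) (b<m : b < m) →
               dist u (vertex a b a<n b<m) ≡ ∣ row u - a ∣ + ∣ col u - b ∣
dist-vertexʳ u a<n b<m =
  cong₂ (λ a b → ∣ row u - a ∣ + ∣ col u - b ∣) (row-vertex a<n b<m) (col-vertex a<n b<m)

towards-row< : (u v : Vertex n m) → towards (row u) (row v) < n
towards-row< u v = towards-< (row< u) (row< v)

towards-col< : (u v : Vertex n m) → towards (col u) (col v) < m
towards-col< u v = towards-< (col< u) (col< v)

rowStep colStep : Vertex n m → Vertex n m → Vertex n m
rowStep u v = vertex (towards (row u) (row v)) (col u) (towards-row< u v) (col< u)
colStep u v = vertex (row u) (towards (col u) (col v)) (row< u) (towards-col< u v)

row-rowStep : (u v : Vertex n m) → row (rowStep u v) ≡ towards (row u) (row v)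
row-rowStep u v = row-vertex (towards-row< u v) (col< u)

col-rowStep : (u v : Vertex n m) → col (rowStep u v) ≡ col u
col-rowStep u v = col-vertex (towards-row< u v) (col< u)

row-colStep : (u v : Vertex n m) → row (colStep u v) ≡ row u
row-colStep u v = row-vertex (row< u) (towards-col< u v)

col-colStep : (u v : Vertex n m) → col (colStep u v) ≡ towards (col u) (col v)
col-colStep u v = col-vertex (row< u) (towards-col< u v)

rowStep-adjacent : (u v : Vertex n m) → row u ≢ row v → Adj u (rowStep u v)
rowStep-adjacent u v r≢ = trans (dist-vertexʳ u (towards-row< u v) (col< u))
                                 (cong₂ _+_ (∣a-towards∣≡1 r≢) (∣n-n∣≡0 (col u)))

colStep-adjacent : (u v : Vertex n m) → col u ≢ col v → Adj u (colStep u v)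
colStep-adjacent u v c≢ = trans (dist-vertexʳ u (row< u) (towards-col< u v))
                                 (cong₂ _+_ (∣n-n∣≡0 (row u)) (∣a-towards∣≡1 c≢))

rowStep-closer : (u v : Vertex n m) → row u ≢ row v → suc (dist (rowStep u v) v) ≡ dist u v
rowStep-closer u v r≢ = trans (cong suc (dist-vertexˡ (towards-row< u v) (col< u) v))
                               (cong (_+ ∣ col u - col v ∣) (towards-closer r≢))

colStep-closer : (u v : Vertex n m) → col u ≢ col v → suc (dist (colStep u v) v) ≡ dist u v
colStep-closer u v c≢ = begin
  suc (dist (colStep u v) v)
    ≡⟨ cong suc (dist-vertexˡ (row< u) (towards-col< u v) v) ⟩
  suc (∣ row u - row v ∣ + ∣ towards (col u) (col v) - col v ∣)
    ≡⟨ +-suc _ _ ⟨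
  ∣ row u - row v ∣ + suc ∣ towards (col u) (col v) - col v ∣
    ≡⟨ cong (∣ row u - row v ∣ +_) (towards-closer c≢) ⟩
  dist u v
    ∎
  where open ≡-Reasoning

∈S-∉S : {X : VSubset n m} {w : Vertex n m} → w ∈S X → w ∉S X → ⊥
∈S-∉S w∈ w∉ with trans (sym w∈) w∉
... | ()

module FreeGeodesics {n m : ℕ} (X : VSubset n m)
  (row-convex : ∀ p q r → row p ≡ row q → row q ≡ row r → col p < col q → col q < col r →
                p ∉S X → r ∉S X → q ∉S X)
  (col-convex : ∀ p q r → col p ≡ col q → col q ≡ col r → row p < row q → row q < row r →
                p ∉S X → r ∉S X → q ∉S X)
  (no-diagonal : ∀ p q → ∣ row p - row q ∣ ≡ 1 → ∣ col p - col q ∣ ≡ 1 → p ∉S X ⊎ q ∉S X)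
  where

  FreeStep : Vertex n m → Vertex n m → Set
  FreeStep u v = Σ[ w ∈ Vertex n m ] Adj u w × suc (dist w v) ≡ dist u v × w ∉S X

  private
    by-row : {u v : Vertex n m} → row u ≢ row v → rowStep u v ∉S X → FreeStep u v
    by-row {u} {v} r≢ free = rowStep u v , rowStep-adjacent u v r≢ , rowStep-closer u v r≢ , free

    by-col : {u v : Vertex n m} → col u ≢ col v → colStep u v ∉S X → FreeStep u v
    by-col {u} {v} c≢ free = colStep u v , colStep-adjacent u v c≢ , colStep-closer u v c≢ , free

  col-free : {u q v : Vertex n m} → col u ≡ col q → col q ≡ col v →
             row q ≡ row v ⊎ StrictlyBetween (row u) (row q) (row v) → u ∉S X → v ∉S X → q ∉S X
  col-free {u} {q} {v} u≡q q≡v (inj₁ q≡v′) u∉ v∉ = subst (_∉S X) (vertex-≡ (sym q≡v′) (sym q≡v)) v∉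
  col-free {u} {q} {v} u≡q q≡v (inj₂ (inj₁ (u<q , q<v))) u∉ v∉ = col-convex u q v u≡q q≡v u<q q<v u∉ v∉
  col-free {u} {q} {v} u≡q q≡v (inj₂ (inj₂ (v<q , q<u))) u∉ v∉ =
    col-convex v q u (sym q≡v) (sym u≡q) v<q q<u v∉ u∉

  row-free : {u q v : Vertex n m} → row u ≡ row q → row q ≡ row v →
             col q ≡ col v ⊎ StrictlyBetween (col u) (col q) (col v) → u ∉S X → v ∉S X → q ∉S X
  row-free {u} {q} {v} u≡q q≡v (inj₁ q≡v′) u∉ v∉ = subst (_∉S X) (vertex-≡ (sym q≡v) (sym q≡v′)) v∉
  row-free {u} {q} {v} u≡q q≡v (inj₂ (inj₁ (u<q , q<v))) u∉ v∉ = row-convex u q v u≡q q≡v u<q q<v u∉ v∉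
  row-free {u} {q} {v} u≡q q≡v (inj₂ (inj₂ (v<q , q<u))) u∉ v∉ =
    row-convex v q u (sym q≡v) (sym u≡q) v<q q<u v∉ u∉

  rowStep-free : {u v : Vertex n m} → col u ≡ col v → u ∉S X → v ∉S X → rowStep u v ∉S X
  rowStep-free {u} {v} c≡ = col-free (sym (col-rowStep u v)) (trans (col-rowStep u v) c≡)
    (subst (λ t → t ≡ row v ⊎ StrictlyBetween (row u) t (row v)) (sym (row-rowStep u v))
           (towards-reaches-or-between (row u) (row v)))

  colStep-free : {u v : Vertex n m} → row u ≡ row v → u ∉S X → v ∉S X → colStep u v ∉S X
  colStep-free {u} {v} r≡ = row-free (sym (row-colStep u v)) (trans (row-colStep u v) r≡)
    (subst (λ t → t ≡ col v ⊎ StrictlyBetween (col u) t (col v)) (sym (col-colStep u v))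
           (towards-reaches-or-between (col u) (col v)))

  -- The two steps are diagonal neighbours, so one of them is free.
  free-step : {u v : Vertex n m} → u ∉S X → v ∉S X → u ≢ v → FreeStep u v
  free-step {u} {v} u∉ v∉ u≢v with row u ≟ row v | col u ≟ col v
  ... | yes r≡ | yes c≡ = ⊥-elim (u≢v (vertex-≡ r≡ c≡))
  ... | no r≢ | yes c≡ = by-row r≢ (rowStep-free c≡ u∉ v∉)
  ... | yes r≡ | no c≢ = by-col c≢ (colStep-free r≡ u∉ v∉)
  ... | no r≢ | no c≢ = [ by-row r≢ , by-col c≢ ]′ (no-diagonal (rowStep u v) (colStep u v) rows cols)
    where
    rows : ∣ row (rowStep u v) - row (colStep u v) ∣ ≡ 1
    rows = trans (cong₂ ∣_-_∣ (row-rowStep u v) (row-colStep u v))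
                 (trans (∣-∣-comm (towards (row u) (row v)) (row u)) (∣a-towards∣≡1 r≢))
    cols : ∣ col (rowStep u v) - col (colStep u v) ∣ ≡ 1
    cols = trans (cong₂ ∣_-_∣ (col-rowStep u v) (col-colStep u v)) (∣a-towards∣≡1 c≢)

  FreeWalk : Vertex n m → Vertex n m → Set
  FreeWalk u v = Σ[ P ∈ Walk u v ] walkLength P ≡ dist u v × (∀ w → w ∈ walkVertices P → w ∉S X)

  free-geodesic : {u v : Vertex n m} → u ∉S X → v ∉S X → FreeWalk u v
  free-geodesic = go _ refl
    where
    go : ∀ {u v} k → dist u v ≡ k → u ∉S X → v ∉S X → FreeWalk u v
    go {u} {v} zero d u∉ v∉ with refl ← dist≡0 {u = u} {v} d = [] , sym d , λ { _ (here refl) → u∉ }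
    go {u} (suc k) d u∉ v∉ with free-step u∉ v∉ (λ { refl → 0≢1+n (trans (sym (dist-self u)) d) })
    ... | w , u~w , closer , w∉ with P , ∣P∣ , free ← go k (suc-injective (trans closer d)) w∉ v∉ =
      u~w ∷ P , trans (cong suc ∣P∣) closer ,
      λ { _ (here refl) → u∉ ; x (there x∈) → free x x∈ }

  free-visible : {u v : Vertex n m} → u ∉S X → v ∉S X → Visible X u v
  free-visible u∉ v∉ with P , ∣P∣ , free ← free-geodesic u∉ v∉ =
    visible-geodesic X P ∣P∣ λ w w∈ w∈X → ⊥-elim (∈S-∉S {X = X} w∈X (free w w∈))

  visible-detour : (u u′ v′ v : Vertex n m) → Adj u u′ → Adj v′ v → u′ ∉S X → v′ ∉S X →
                   2 + dist u′ v′ ≡ dist u v → Visible X u v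
  visible-detour u u′ v′ v u~u′ v′~v u′∉ v′∉ d with P , ∣P∣ , free ← free-geodesic u′∉ v′∉ =
    visible-geodesic X (u~u′ ∷ (P ∷ʳ v′~v))
      (trans (cong suc (walkLength-∷ʳ P v′~v)) (trans (cong (2 +_) ∣P∣) d))
      λ where
        _ (here refl) _ → inj₁ refl
        w (there w∈) w∈X → Sum.map₁ (λ w∈P → ⊥-elim (∈S-∉S {X = X} w∈X (free w w∈P)))
                                    (∈-walkVertices-∷ʳ P v′~v w∈)

module Unobstructed {n m : ℕ} = FreeGeodesics {n} {m} (λ _ → false)
  (λ _ _ _ _ _ _ _ _ _ → refl) (λ _ _ _ _ _ _ _ _ _ → refl) (λ _ _ _ _ → inj₁ refl)

geodesic : (u v : Vertex n m) → Σ[ P ∈ Walk u v ] walkLength P ≡ dist u v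
geodesic u v with P , ∣P∣ , _ ← Unobstructed.free-geodesic {u = u} {v} refl refl = P , ∣P∣

shortest-length : {u v : Vertex n m} (P : Walk u v) → IsShortest P → walkLength P ≡ dist u v
shortest-length {u = u} {v} P P-short with Q , ∣Q∣ ← geodesic u v =
  ≤-antisym (≤-trans (P-short Q) (≤-reflexive ∣Q∣)) (dist≤walkLength P)

-- Necessary conditions on dual mutual-visibility sets

interior-positions : ∀ L {j} → 2 ≤ j → j + 3 ≤ L → 1 < j × j < L ∸ 2 × L ∸ 2 < L ∸ 1 × L ∸ 1 < L
interior-positions (suc (suc L)) {j} 2≤j j+3≤L =
  2≤j , ≤-pred (≤-pred (subst (_≤ suc (suc L)) (+-comm j 3) j+3≤L)) , ≤-refl , ≤-refl
interior-positions zero {j} 2≤j j+3≤L with () ← ≤-trans (m≤n+m 3 j) j+3≤L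
interior-positions (suc zero) {j} 2≤j j+3≤L with s≤s () ← ≤-trans (m≤n+m 3 j) j+3≤L

-- The lines are the fibres of A and B is the position along a line; along v b is the vertex
-- at position b on the line through v.
module Lines {n m : ℕ} (A B : Vertex n m → ℕ)
  (dist-AB : ∀ u v → dist u v ≡ ∣ A u - A v ∣ + ∣ B u - B v ∣)
  (AB-injective : ∀ {u v} → A u ≡ A v → B u ≡ B v → u ≡ v)
  (L : ℕ) (along : (v : Vertex n m) (b : ℕ) → b < L → Vertex n m)
  (A-along : ∀ v b (b<L : b < L) → A (along v b b<L) ≡ A v)
  (B-along : ∀ v b (b<L : b < L) → B (along v b b<L) ≡ b)
  where

  infix 4 _◁_
  _◁_ : Vertex n m → Vertex n m → Set
  p ◁ q = A p ≡ A q × B p < B q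

  ◁-trans : {p q r : Vertex n m} → p ◁ q → q ◁ r → p ◁ r
  ◁-trans (Ap≡Aq , Bp<Bq) (Aq≡Ar , Bq<Br) = trans Ap≡Aq Aq≡Ar , <-trans Bp<Bq Bq<Br

  B-step : (u w : Vertex n m) → Adj u w → B w ≤ suc (B u)
  B-step u w u~w = begin
    B w                      ≤⟨ m≤n+∣m-n∣ (B w) (B u) ⟩
    B u + ∣ B w - B u ∣      ≤⟨ +-monoʳ-≤ (B u) (m≤n+m _ ∣ A w - A u ∣) ⟩
    B u + (∣ A w - A u ∣ + ∣ B w - B u ∣) ≡⟨ cong (B u +_) (sym (dist-AB w u)) ⟩
    B u + dist w u           ≡⟨ cong (B u +_) (adj-sym {u = u} {w} u~w) ⟩
    B u + 1                  ≡⟨ +-comm (B u) 1 ⟩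
    suc (B u)                ∎
    where open ≤-Reasoning

  intermediate-value : {p r : Vertex n m} (P : Walk p r) {c : ℕ} → B p ≤ c → c ≤ B r →
                       Σ[ w ∈ Vertex n m ] w ∈ walkVertices P × B w ≡ c
  intermediate-value {p} [] Bp≤c c≤Bp = p , here refl , ≤-antisym Bp≤c c≤Bp
  intermediate-value {p} (_∷_ {w = x} p~x P) {c} Bp≤c c≤Br with B p ≟ c
  ... | yes Bp≡c = p , here refl , Bp≡c
  ... | no Bp≢c
    with w , w∈P , Bw≡c ← intermediate-value P (≤-trans (B-step p x p~x) (≤∧≢⇒< Bp≤c Bp≢c)) c≤Br =
    w , there w∈P , Bw≡c

  geodesic-stays-on-line : {p r : Vertex n m} → A p ≡ A r → (P : Walk p r) → IsShortest P →
                           {w : Vertex n m} → w ∈ walkVertices P → A w ≡ A p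
  geodesic-stays-on-line {p} {r} Ap≡Ar P P-short {w} w∈P =
    sym (∣m-n∣≡0⇒m≡n (n≤0⇒n≡0 (+-cancelʳ-≤ S _ 0 off-line≤0)))
    where
    S = ∣ B p - B r ∣
    off-line≤0 : ∣ A p - A w ∣ + S ≤ 0 + S
    off-line≤0 = begin
      ∣ A p - A w ∣ + S
        ≤⟨ +-mono-≤ (m≤m+n _ ∣ A w - A r ∣) (∣-∣-triangle (B p) (B w) (B r)) ⟩
      (∣ A p - A w ∣ + ∣ A w - A r ∣) + (∣ B p - B w ∣ + ∣ B w - B r ∣)
        ≡⟨ interchange ∣ A p - A w ∣ _ _ _ ⟩
      (∣ A p - A w ∣ + ∣ B p - B w ∣) + (∣ A w - A r ∣ + ∣ B w - B r ∣)
        ≡⟨ cong₂ _+_ (dist-AB p w) (dist-AB w r) ⟨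
      dist p w + dist w r  ≤⟨ dist-via P w∈P ⟩
      walkLength P         ≡⟨ shortest-length P P-short ⟩
      dist p r             ≡⟨ dist-AB p r ⟩
      ∣ A p - A r ∣ + S    ≡⟨ cong (λ a → ∣ A p - a ∣ + S) Ap≡Ar ⟨
      ∣ A p - A p ∣ + S    ≡⟨ cong (_+ S) (∣n-n∣≡0 (A p)) ⟩
      0 + S                ∎
      where open ≤-Reasoning

  shortest-through : {p q r : Vertex n m} → p ◁ q → q ◁ r → (P : Walk p r) → IsShortest P →
                     q ∈ walkVertices P
  shortest-through {p} {q} {r} (Ap≡Aq , Bp<Bq) (Aq≡Ar , Bq<Br) P P-short
    with w , w∈P , Bw≡Bq ← intermediate-value P (<⇒≤ Bp<Bq) (<⇒≤ Bq<Br) =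
    subst (_∈ walkVertices P)
      (AB-injective (trans (geodesic-stays-on-line (trans Ap≡Aq Aq≡Ar) P P-short w∈P) Ap≡Aq) Bw≡Bq) w∈P

  module _ {X : VSubset n m} (X-dual : IsDualMV X) where

    same-colour-visible : {p r : Vertex n m} → X p ≡ X r → Visible X p r
    same-colour-visible {p} {r} Xp≡Xr with X p in Xp
    ... | true = proj₁ X-dual p r Xp (sym Xp≡Xr)
    ... | false = proj₂ X-dual p r Xp (sym Xp≡Xr)

    separates : {p q r : Vertex n m} → p ◁ q → q ◁ r → q ∈S X → X p ≢ X r
    separates p◁q q◁r q∈X Xp≡Xr
      with P , P-short , avoids ← same-colour-visible Xp≡Xr
      with avoids _ (shortest-through p◁q q◁r P P-short) q∈X
    ... | inj₁ refl = <-irrefl refl (proj₂ p◁q)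
    ... | inj₂ refl = <-irrefl refl (proj₂ q◁r)

    no-interior-point : {p₀ p₁ p₂ p₃ p₄ : Vertex n m} → p₀ ◁ p₁ → p₁ ◁ p₂ → p₂ ◁ p₃ → p₃ ◁ p₄ → p₂ ∉S X
    no-interior-point {p₀} {p₁} {p₂} {p₃} {p₄} p₀◁p₁ p₁◁p₂ p₂◁p₃ p₃◁p₄ with X p₂ in p₂∈X
    ... | false = refl
    ... | true = ⊥-elim (colouring-impossible (X p₀) (X p₁) (X p₃) (X p₄)
      (separates (◁-trans p₀◁p₁ p₁◁p₂) p₂◁p₃ p₂∈X)
      (separates p₁◁p₂ p₂◁p₃ p₂∈X)
      (separates (◁-trans p₀◁p₁ p₁◁p₂) (◁-trans p₂◁p₃ p₃◁p₄) p₂∈X)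
      (λ p₁∈X p₀∈X → separates p₀◁p₁ p₁◁p₂ p₁∈X (trans p₀∈X (sym p₂∈X)))
      (λ p₃∈X p₄∈X → separates p₂◁p₃ p₃◁p₄ p₃∈X (trans p₂∈X (sym p₄∈X))))
      where
      colouring-impossible : ∀ x₀ x₁ x₃ x₄ → x₀ ≢ x₃ → x₁ ≢ x₃ → x₀ ≢ x₄ →
                             (x₁ ≡ true → x₀ ≢ true) → (x₃ ≡ true → x₄ ≢ true) → ⊥
      colouring-impossible true  _     true  _     s₀₃ _   _   _  _  = s₀₃ refl
      colouring-impossible false _     false _     s₀₃ _   _   _  _  = s₀₃ refl
      colouring-impossible true  true  false _     _   _   _   s₁ _  = s₁ refl refl
      colouring-impossible true  false false _     _   s₁₃ _   _  _  = s₁₃ refl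
      colouring-impossible false true  true  _     _   s₁₃ _   _  _  = s₁₃ refl
      colouring-impossible false false true  false _   _   s₀₄ _  _  = s₀₄ refl
      colouring-impossible false false true  true  _   _   _   _  s₃ = s₃ refl refl

    interior-point-free : (w : Vertex n m) → 2 ≤ B w → B w + 3 ≤ L → w ∉S X
    interior-point-free w 2≤Bw Bw+3≤L with interior-positions L 2≤Bw Bw+3≤L
    ... | 1<Bw , Bw<L-2 , L-2<L-1 , L-1<L =
      no-interior-point (◁-along 0<L 1<L (s≤s z≤n)) (along-◁ 1<L 1<Bw)
                        (◁-along′ L-2<L Bw<L-2) (◁-along L-2<L L-1<L L-2<L-1)
      where
      1<L = <-trans 1<Bw (<-trans Bw<L-2 (<-trans L-2<L-1 L-1<L))
      0<L = <-trans (s≤s z≤n) 1<L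
      L-2<L = <-trans L-2<L-1 L-1<L

      ◁-along : ∀ {a b} (a<L : a < L) (b<L : b < L) → a < b → along w a a<L ◁ along w b b<L
      ◁-along a<L b<L a<b =
        trans (A-along w _ a<L) (sym (A-along w _ b<L)) ,
        subst₂ _<_ (sym (B-along w _ a<L)) (sym (B-along w _ b<L)) a<b

      along-◁ : ∀ {a} (a<L : a < L) → a < B w → along w a a<L ◁ w
      along-◁ a<L a<Bw = A-along w _ a<L , subst (_< B w) (sym (B-along w _ a<L)) a<Bw

      ◁-along′ : ∀ {b} (b<L : b < L) → B w < b → w ◁ along w b b<L
      ◁-along′ b<L Bw<b = sym (A-along w _ b<L) , subst (B w <_) (sym (B-along w _ b<L)) Bw<b

module Rows {n m : ℕ} = Lines {n} {m} row col (λ _ _ → refl) vertex-≡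
  m (λ v b b<m → proj₁ v , fromℕ< b<m) (λ _ _ _ → refl) (λ _ _ p → toℕ-fromℕ< p)

module Cols {n m : ℕ} = Lines {n} {m} col row
  (λ u v → +-comm ∣ row u - row v ∣ _) (λ c≡ r≡ → vertex-≡ r≡ c≡)
  n (λ v a a<n → fromℕ< a<n , proj₂ v) (λ _ _ _ → refl) (λ _ _ p → toℕ-fromℕ< p)

Saturated : VSubset n m → Vertex n m → Set
Saturated X u = ∀ w → Adj u w → w ∈S X

head-∈-walkVertices : {u v : Vertex n m} (P : Walk u v) → u ∈ walkVertices P
head-∈-walkVertices [] = here refl
head-∈-walkVertices (_ ∷ _) = here refl

saturated-visible : {X : VSubset n m} {u v : Vertex n m} → Saturated X u → Visible X u v →
                    v ≡ u ⊎ (Adj u v × v ∈S X)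
saturated-visible sat ([] , _) = inj₁ refl
saturated-visible {u = u} sat (_∷_ {w = w} u~w Q , _ , avoids)
  with avoids w (there (head-∈-walkVertices Q)) (sat w u~w)
... | inj₁ refl = ⊥-elim (adj-irrefl {u = u} u~w)
... | inj₂ refl = inj₂ (u~w , sat w u~w)

saturated-member : {X : VSubset n m} → IsDualMV X → {u : Vertex n m} → Saturated X u → u ∈S X →
                   ∀ v → v ∈S X → v ≡ u ⊎ Adj u v
saturated-member X-dual {u} sat u∈X v v∈X =
  Sum.map₂ proj₁ (saturated-visible sat (proj₁ X-dual u v u∈X v∈X))

saturated-nonmember : {X : VSubset n m} → IsDualMV X → {u : Vertex n m} → Saturated X u → u ∉S X →
                      ∀ v → v ∉S X → v ≡ u
saturated-nonmember {X = X} X-dual {u} sat u∉X v v∉X with saturated-visible sat (proj₂ X-dual u v u∉X v∉X)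
... | inj₁ v≡u = v≡u
... | inj₂ (_ , v∈X) = ⊥-elim (∈S-∉S {X = X} v∈X v∉X)

-- Counting

private
  T⇒≡ : ∀ {x} → T x → x ≡ true
  T⇒≡ = Equivalence.to T-≡

  ≡⇒T : ∀ {x} → x ≡ true → T x
  ≡⇒T = Equivalence.from T-≡

  ∧-intro : ∀ {x y} → x ≡ true → y ≡ true → x ∧ y ≡ true
  ∧-intro refl refl = refl

  ∨-introˡ : ∀ {x y} → x ≡ true → x ∨ y ≡ true
  ∨-introˡ refl = refl

  ∨-introʳ : ∀ x {y} → y ≡ true → x ∨ y ≡ true
  ∨-introʳ x refl = ∨-zeroʳ x

  ⇒-intro : ∀ {x y} → (x ≡ true → y ≡ true) → not x ∨ y ≡ true
  ⇒-intro {true} x⇒y = x⇒y refl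
  ⇒-intro {false} x⇒y = refl

  ⇒-elim : ∀ {x y} → not x ∨ y ≡ true → x ≡ true → y ≡ true
  ⇒-elim y≡ refl = y≡

∈-++-∷-drop : ∀ {A : Set} (ys₁ : List A) {x y : A} {ys₂ : List A} → y ∈ ys₁ ++ x ∷ ys₂ → x ≢ y →
              y ∈ ys₁ ++ ys₂
∈-++-∷-drop [] (here refl) x≢y = ⊥-elim (x≢y refl)
∈-++-∷-drop [] (there y∈) x≢y = y∈
∈-++-∷-drop (z ∷ ys₁) (here refl) x≢y = here refl
∈-++-∷-drop (z ∷ ys₁) (there y∈) x≢y = there (∈-++-∷-drop ys₁ y∈ x≢y)

unique-⊆⇒length≤ : ∀ {A : Set} {xs ys : List A} → Unique xs → (∀ {x} → x ∈ xs → x ∈ ys) →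
                    length xs ≤ length ys
unique-⊆⇒length≤ {xs = []} _ _ = z≤n
unique-⊆⇒length≤ {xs = x ∷ xs} {ys} (x∉xs ∷ xs-unique) xs⊆ys
  with ys₁ , ys₂ , refl ← ∈-∃++ (xs⊆ys (here refl)) = begin
    suc (length xs)              ≤⟨ s≤s (unique-⊆⇒length≤ xs-unique drop-x) ⟩
    suc (length (ys₁ ++ ys₂))    ≡⟨ cong suc (length-++ ys₁) ⟩
    suc (length ys₁ + length ys₂) ≡⟨ +-suc (length ys₁) _ ⟨
    length ys₁ + suc (length ys₂) ≡⟨ length-++ ys₁ ⟨
    length (ys₁ ++ x ∷ ys₂)      ∎
  where
  open ≤-Reasoning
  drop-x : ∀ {y} → y ∈ xs → y ∈ ys₁ ++ ys₂
  drop-x y∈xs = ∈-++-∷-drop ys₁ (xs⊆ys (there y∈xs)) (All.lookup x∉xs y∈xs)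

allVertices-unique : Unique (allVertices n m)
allVertices-unique {n} {m} = cartesianProduct⁺ (allFin⁺ n) (allFin⁺ m)

∈-allVertices : (v : Vertex n m) → v ∈ allVertices n m
∈-allVertices (i , j) = ∈-cartesianProduct⁺ (∈-allFin i) (∈-allFin j)

card≤count : (X : VSubset n m) (ws : List (Vertex n m)) → (∀ {w} → w ∈S X → w ∈ ws) →
             card X ≤ length (filter (T? ∘ X) ws)
card≤count {n} {m} X ws X⊆ws = unique-⊆⇒length≤ (filter⁺ (T? ∘ X) allVertices-unique) λ w∈ →
  let Xw = proj₂ (∈-filter⁻ (T? ∘ X) {xs = allVertices n m} w∈) in
  ∈-filter⁺ (T? ∘ X) (X⊆ws (T⇒≡ Xw)) Xw

length-filter-map : ∀ {A : Set} (f : A → Bool) xs →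
                    length (filter T? (map f xs)) ≡ length (filter (T? ∘ f) xs)
length-filter-map f [] = refl
length-filter-map f (x ∷ xs) with f x
... | true = cong suc (length-filter-map f xs)
... | false = length-filter-map f xs

-- Reduction to at most four rows and columns

-- kept L k is the k-th of the lines 0, 1, L-2, L-1 (of all lines when L ≤ 3).
kept : ℕ → ℕ → ℕ
kept L zero = zero
kept L (suc zero) = 1
kept L (suc (suc k)) = suc (suc (k + (L ∸ 4)))

#kept : ℕ → ℕ
#kept (suc (suc (suc (suc L)))) = 4
#kept L = L

kept-< : ∀ L {k} → 2 ≤ L → k < #kept L → kept L k < L
kept-< (suc zero) (s≤s ())
kept-< (suc (suc L)) {zero} _ _ = s≤s z≤n
kept-< (suc (suc L)) {suc zero} _ _ = s≤s (s≤s z≤n)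
kept-< (suc (suc zero)) {suc (suc k)} _ (s≤s (s≤s ()))
kept-< (suc (suc (suc zero))) {suc (suc zero)} _ _ = ≤-refl
kept-< (suc (suc (suc zero))) {suc (suc (suc k))} _ (s≤s (s≤s (s≤s ())))
kept-< (suc (suc (suc (suc L)))) {suc (suc zero)} _ _ = s≤s (s≤s (n≤1+n (suc L)))
kept-< (suc (suc (suc (suc L)))) {suc (suc (suc zero))} _ _ = ≤-refl
kept-< (suc (suc (suc (suc L)))) {suc (suc (suc (suc k)))} _ (s≤s (s≤s (s≤s (s≤s ()))))

kept-strictMono : ∀ L {k k′} → k < k′ → kept L k < kept L k′
kept-strictMono L {zero} {suc zero} _ = s≤s z≤n
kept-strictMono L {zero} {suc (suc k′)} _ = s≤s z≤n
kept-strictMono L {suc zero} {suc (suc k′)} _ = s≤s (s≤s z≤n)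
kept-strictMono L {suc zero} {suc zero} (s≤s ())
kept-strictMono L {suc (suc k)} {suc (suc k′)} (s≤s (s≤s k<k′)) = s≤s (s≤s (+-monoˡ-< (L ∸ 4) k<k′))

kept-injective : ∀ L {k k′} → kept L k ≡ kept L k′ → k ≡ k′
kept-injective L {k} {k′} eq with <-cmp k k′
... | tri< k<k′ _ _ = ⊥-elim (<⇒≢ (kept-strictMono L k<k′) eq)
... | tri≈ _ k≡k′ _ = k≡k′
... | tri> _ _ k′<k = ⊥-elim (<⇒≢ (kept-strictMono L k′<k) (sym eq))

2≤#kept : ∀ {L} → 2 ≤ L → 2 ≤ #kept L
2≤#kept {suc zero} (s≤s ())
2≤#kept {suc (suc zero)} _ = ≤-refl
2≤#kept {suc (suc (suc zero))} _ = s≤s (s≤s z≤n)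
2≤#kept {suc (suc (suc (suc L)))} _ = s≤s (s≤s z≤n)

kept-or-interior : ∀ L {j} → 2 ≤ L → j < L →
                   (Σ[ k ∈ ℕ ] k < #kept L × kept L k ≡ j) ⊎ (2 ≤ j × j + 3 ≤ L)
kept-or-interior L {zero} 2≤L _ = inj₁ (0 , ≤-trans (s≤s z≤n) (2≤#kept 2≤L) , refl)
kept-or-interior L {suc zero} 2≤L _ = inj₁ (1 , 2≤#kept 2≤L , refl)
kept-or-interior (suc (suc zero)) {suc (suc j)} _ (s≤s (s≤s ()))
kept-or-interior (suc (suc (suc zero))) {suc (suc zero)} _ _ = inj₁ (2 , ≤-refl , refl)
kept-or-interior (suc (suc (suc zero))) {suc (suc (suc j))} _ (s≤s (s≤s (s≤s ())))
kept-or-interior (suc (suc (suc (suc t)))) {suc (suc j)} _ (s≤s (s≤s j<2+t)) with j <? t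
... | yes j<t = inj₂ (s≤s (s≤s z≤n) , s≤s (s≤s (subst (_≤ 2 + t) (+-comm 3 j) (s≤s (s≤s j<t)))))
... | no j≮t = inj₁ (2 + (j ∸ t) , s≤s (s≤s j∸t<2) , cong (suc ∘ suc) (m∸n+n≡m (≮⇒≥ j≮t)))
  where
  j∸t<2 : j ∸ t < 2
  j∸t<2 = subst (j ∸ t <_) (m+n∸n≡m 2 t) (∸-monoˡ-< j<2+t (≮⇒≥ j≮t))

kept-last : ∀ L → 2 ≤ L → kept L (#kept L ∸ 1) ≡ L ∸ 1
kept-last (suc zero) (s≤s ())
kept-last (suc (suc zero)) _ = refl
kept-last (suc (suc (suc zero))) _ = refl
kept-last (suc (suc (suc (suc L)))) _ = refl

kept-penultimate : ∀ L → 2 ≤ L → kept L (#kept L ∸ 2) ≡ L ∸ 2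
kept-penultimate (suc zero) (s≤s ())
kept-penultimate (suc (suc zero)) _ = refl
kept-penultimate (suc (suc (suc zero))) _ = refl
kept-penultimate (suc (suc (suc (suc L)))) _ = refl

-- An end of a line of length K, paired with the only index adjacent to it.
data End (K : ℕ) : ℕ × ℕ → Set where
  first : End K (0 , 1)
  last : End K (K ∸ 1 , K ∸ 2)

m+n≡1 : ∀ a b → a + b ≡ 1 → (a ≡ 0 × b ≡ 1) ⊎ (a ≡ 1 × b ≡ 0)
m+n≡1 zero b a+b≡1 = inj₁ (refl , a+b≡1)
m+n≡1 (suc zero) zero _ = inj₂ (refl , refl)

last-neighbour : ∀ {L x} → x < L → ∣ L ∸ 1 - x ∣ ≡ 1 → x ≡ L ∸ 2
last-neighbour {suc zero} {zero} _ ()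
last-neighbour {suc zero} {suc x} (s≤s ())
last-neighbour {suc (suc L)} (s≤s x≤1+L) d = go L x≤1+L d
  where
  go : ∀ a {x} → x ≤ suc a → ∣ suc a - x ∣ ≡ 1 → x ≡ a
  go zero {zero} _ _ = refl
  go zero {suc zero} _ ()
  go zero {suc (suc x)} (s≤s ())
  go (suc a) {zero} _ ()
  go (suc a) {suc x} (s≤s x≤1+a) d = cong suc (go a x≤1+a d)

end-< : ∀ {K b b′} → 2 ≤ K → End K (b , b′) → b < K × b′ < K
end-< 2≤K first = ≤-trans (s≤s z≤n) 2≤K , 2≤K
end-< {suc zero} (s≤s ()) last
end-< {suc (suc K)} _ last = ≤-refl , ≤-trans (n<1+n K) (n≤1+n (suc K))

kept-end-neighbour : ∀ L {b b′} → 2 ≤ L → End (#kept L) (b , b′) →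
                     ∀ {x} → x < L → ∣ kept L b - x ∣ ≡ 1 → x ≡ kept L b′
kept-end-neighbour L 2≤L first _ d = d
kept-end-neighbour L 2≤L last x<L d
  rewrite kept-last L 2≤L | kept-penultimate L 2≤L = last-neighbour x<L d

Grid : Set
Grid = List (List Bool)

at : List Bool → ℕ → Bool
at [] _ = false
at (x ∷ xs) zero = x
at (x ∷ xs) (suc j) = at xs j

entry : Grid → ℕ → ℕ → Bool
entry [] _ _ = false
entry (r ∷ R) zero j = at r j
entry (r ∷ R) (suc i) j = entry R i j

weight : Grid → ℕ
weight R = length (filter T? (concat R))

allBelow : ℕ → (ℕ → Bool) → Bool
allBelow zero f = true
allBelow (suc k) f = f k ∧ allBelow k f

ordered : ℕ → ℕ → ℕ → Bool
ordered a b c = (a <ᵇ b) ∧ (b <ᵇ c)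

separated : Bool → Bool → Bool → Bool
separated x y z = not y ∨ (x xor z)

rowsSeparated colsSeparated : ℕ → ℕ → Grid → Bool
rowsSeparated N M R = allBelow N λ i → allBelow M λ a → allBelow M λ b → allBelow M λ c →
  not (ordered a b c) ∨ separated (entry R i a) (entry R i b) (entry R i c)
colsSeparated N M R = allBelow M λ j → allBelow N λ a → allBelow N λ b → allBelow N λ c →
  not (ordered a b c) ∨ separated (entry R a j) (entry R b j) (entry R c j)

isCell : ℕ → ℕ → ℕ → ℕ → Bool
isCell k l a b = (k ≡ᵇ a) ∧ (l ≡ᵇ b)

forEachEnd : ℕ → (ℕ × ℕ → Bool) → Bool
forEachEnd K f = f (0 , 1) ∧ f (K ∸ 1 , K ∸ 2)

onlyAt : ℕ → ℕ → Grid → ℕ → ℕ → ℕ → ℕ → Bool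
onlyAt N M R a a′ b b′ = allBelow N λ k → allBelow M λ l →
  not (entry R k l) ∨ (isCell k l a b ∨ (isCell k l a b′ ∨ isCell k l a′ b))

exceptAt : ℕ → ℕ → Grid → ℕ → ℕ → Bool
exceptAt N M R a b = allBelow N λ k → allBelow M λ l → entry R k l ∨ isCell k l a b

cornerOK : ℕ → ℕ → Grid → ℕ × ℕ → ℕ × ℕ → Bool
cornerOK N M R (a , a′) (b , b′) =
  not (entry R a b′ ∧ entry R a′ b) ∨ (if entry R a b then onlyAt N M R a a′ b b′ else exceptAt N M R a b)

cornersOK : ℕ → ℕ → Grid → Bool
cornersOK N M R = forEachEnd N λ a → forEachEnd M λ b → cornerOK N M R a b

admissible : ℕ → ℕ → Grid → Bool
admissible N M R = rowsSeparated N M R ∧ (colsSeparated N M R ∧ cornersOK N M R)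

allRows : ℕ → (List Bool → Bool) → Bool
allRows zero f = f []
allRows (suc k) f = allRows k (λ r → f (true ∷ r)) ∧ allRows k (λ r → f (false ∷ r))

allGrids : ℕ → ℕ → (Grid → Bool) → Bool
allGrids zero M f = f []
allGrids (suc N) M f = allRows M λ r → allGrids N M (λ R → f (r ∷ R))

BoundedBy : ℕ → ℕ → ℕ → Bool
BoundedBy N M B = allGrids N M λ R → not (admissible N M R) ∨ (weight R ≤ᵇ B)

allBelow-complete : ∀ k (f : ℕ → Bool) → (∀ {i} → i < k → f i ≡ true) → allBelow k f ≡ true
allBelow-complete zero f _ = refl
allBelow-complete (suc k) f all-f = ∧-intro (all-f ≤-refl) (allBelow-complete k f (all-f ∘ m<n⇒m<1+n))

forEachEnd-complete : ∀ K (f : ℕ × ℕ → Bool) → (∀ {e} → End K e → f e ≡ true) → forEachEnd K f ≡ true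
forEachEnd-complete K f all-f = ∧-intro (all-f first) (all-f last)

ordered-sound : ∀ a b c → ordered a b c ≡ true → a < b × b < c
ordered-sound a b c ord =
  <ᵇ⇒< a b (≡⇒T (∧-conicalˡ _ _ ord)) , <ᵇ⇒< b c (≡⇒T (∧-conicalʳ (a <ᵇ b) _ ord))

separated-intro : ∀ {x y z} → (y ≡ true → x ≢ z) → separated x y z ≡ true
separated-intro {y = false} _ = refl
separated-intro {true} {true} {true} sep = ⊥-elim (sep refl refl)
separated-intro {true} {true} {false} _ = refl
separated-intro {false} {true} {true} _ = refl
separated-intro {false} {true} {false} sep = ⊥-elim (sep refl refl)

isCell-intro : ∀ {k l a b} → k ≡ a → l ≡ b → isCell k l a b ≡ true
isCell-intro {k} {l} refl refl = ∧-intro (T⇒≡ (≡⇒≡ᵇ k k refl)) (T⇒≡ (≡⇒≡ᵇ l l refl))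

allRows-sound : ∀ k (f : List Bool → Bool) → allRows k f ≡ true → ∀ r → length r ≡ k → f r ≡ true
allRows-sound zero f all-f [] refl = all-f
allRows-sound (suc k) f all-f (true ∷ r) refl = allRows-sound k _ (∧-conicalˡ _ _ all-f) r refl
allRows-sound (suc k) f all-f (false ∷ r) refl = allRows-sound k _ (∧-conicalʳ _ _ all-f) r refl

allGrids-sound : ∀ N M (f : Grid → Bool) → allGrids N M f ≡ true →
                 ∀ R → length R ≡ N → All (λ r → length r ≡ M) R → f R ≡ true
allGrids-sound zero M f all-f [] refl [] = all-f
allGrids-sound (suc N) M f all-f (r ∷ R) refl (∣r∣ ∷ ∣R∣) =
  allGrids-sound N M _ (allRows-sound M _ all-f r ∣r∣) R refl ∣R∣

bounded-sound : ∀ {N M B} → BoundedBy N M B ≡ true → ∀ R → length R ≡ N → All (λ r → length r ≡ M) R →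
                admissible N M R ≡ true → weight R ≤ B
bounded-sound {N} {M} {B} bounded R ∣R∣ ∣rows∣ adm =
  ≤ᵇ⇒≤ (weight R) B (≡⇒T (⇒-elim (allGrids-sound N M _ bounded R ∣R∣ ∣rows∣) adm))

applyUpTo² : ∀ {A : Set} → (ℕ → ℕ → A) → ℕ → ℕ → List (List A)
applyUpTo² F N M = applyUpTo (λ k → applyUpTo (F k) M) N

at-map-applyUpTo : ∀ {A : Set} (f : A → Bool) (g : ℕ → A) M {l} → l < M → at (map f (applyUpTo g M)) l ≡ f (g l)
at-map-applyUpTo f g (suc M) {zero} _ = refl
at-map-applyUpTo f g (suc M) {suc l} (s≤s l<M) = at-map-applyUpTo f (g ∘ suc) M l<M

entry-tabulated : ∀ {A : Set} (f : A → Bool) F N M {k l} → k < N → l < M →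
                  entry (map (map f) (applyUpTo² F N M)) k l ≡ f (F k l)
entry-tabulated f F (suc N) M {zero} _ l<M = at-map-applyUpTo f (F 0) M l<M
entry-tabulated f F (suc N) M {suc k} (s≤s k<N) l<M = entry-tabulated f (F ∘ suc) N M k<N l<M

length-tabulated : ∀ {A : Set} (f : A → Bool) F N M → length (map (map f) (applyUpTo² F N M)) ≡ N
length-tabulated f F N M = trans (length-map (map f) (applyUpTo² F N M)) (length-applyUpTo _ N)

rows-tabulated : ∀ {A : Set} (f : A → Bool) F N M → All (λ r → length r ≡ M) (map (map f) (applyUpTo² F N M))
rows-tabulated f F zero M = []
rows-tabulated f F (suc N) M =
  trans (length-map f (applyUpTo (F 0) M)) (length-applyUpTo (F 0) M) ∷ rows-tabulated f (F ∘ suc) N M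

module Compression {n m : ℕ} .{{_ : NonZero n}} .{{_ : NonZero m}} (2≤n : 2 ≤ n) (2≤m : 2 ≤ m)
  {X : VSubset n m} (X-dual : IsDualMV X) where

  N M : ℕ
  N = #kept n
  M = #kept m

  -- Reducing mod n and mod m only makes cell total; it does nothing on kept indices.
  cell : ℕ → ℕ → Vertex n m
  cell k l = kept n k mod n , kept m l mod m

  row-cell : ∀ {k} l → k < N → row (cell k l) ≡ kept n k
  row-cell {k} l k<N = trans (toℕ-fromℕ< _) (m<n⇒m%n≡m (kept-< n 2≤n k<N))

  col-cell : ∀ k {l} → l < M → col (cell k l) ≡ kept m l
  col-cell k {l} l<M = trans (toℕ-fromℕ< _) (m<n⇒m%n≡m (kept-< m 2≤m l<M))

  cell-≡ : ∀ {k l} → k < N → l < M → (w : Vertex n m) → row w ≡ kept n k → col w ≡ kept m l →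
           w ≡ cell k l
  cell-≡ {k} {l} k<N l<M w r≡ c≡ =
    vertex-≡ (trans r≡ (sym (row-cell l k<N))) (trans c≡ (sym (col-cell k l<M)))

  cell-injective : ∀ {k l k′ l′} → k < N → l < M → k′ < N → l′ < M → cell k l ≡ cell k′ l′ →
                   k ≡ k′ × l ≡ l′
  cell-injective {k} {l} {k′} {l′} k<N l<M k′<N l′<M eq =
    kept-injective n (trans (sym (row-cell l k<N)) (trans (cong row eq) (row-cell l′ k′<N))) ,
    kept-injective m (trans (sym (col-cell k l<M)) (trans (cong col eq) (col-cell k′ l′<M)))

  X⊆cells : ∀ {w} → w ∈S X → Σ[ k ∈ ℕ ] Σ[ l ∈ ℕ ] k < N × l < M × w ≡ cell k l
  X⊆cells {w} w∈X with kept-or-interior n 2≤n (row< w) | kept-or-interior m 2≤m (col< w)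
  ... | inj₂ (2≤r , r+3≤n) | _ = ⊥-elim (∈S-∉S {X = X} w∈X (Cols.interior-point-free X-dual w 2≤r r+3≤n))
  ... | inj₁ _ | inj₂ (2≤c , c+3≤m) = ⊥-elim (∈S-∉S {X = X} w∈X (Rows.interior-point-free X-dual w 2≤c c+3≤m))
  ... | inj₁ (k , k<N , r≡) | inj₁ (l , l<M , c≡) = k , l , k<N , l<M , cell-≡ k<N l<M w (sym r≡) (sym c≡)

  cells : List (List (Vertex n m))
  cells = applyUpTo² cell N M

  grid : Grid
  grid = map (map X) cells

  entry-grid : ∀ {k l} → k < N → l < M → entry grid k l ≡ X (cell k l)
  entry-grid = entry-tabulated X cell N M

  card≤weight : card X ≤ weight grid
  card≤weight = begin
    card X                                      ≤⟨ card≤count X (concat cells) X∈cells ⟩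
    length (filter (T? ∘ X) (concat cells))     ≡⟨ length-filter-map X (concat cells) ⟨
    length (filter T? (map X (concat cells)))   ≡⟨ cong (length ∘ filter T?) (concat-map cells) ⟨
    weight grid                                 ∎
    where
    open ≤-Reasoning
    X∈cells : ∀ {w} → w ∈S X → w ∈ concat cells
    X∈cells w∈X with k , l , k<N , l<M , refl ← X⊆cells w∈X =
      ∈-concat⁺′ (∈-applyUpTo⁺ (cell k) l<M) (∈-applyUpTo⁺ (λ k → applyUpTo (cell k) M) k<N)

  ◁-row : ∀ {i a b} → i < N → a < M → b < M → a < b → cell i a Rows.◁ cell i b
  ◁-row {i} {a} {b} i<N a<M b<M a<b =
    trans (row-cell a i<N) (sym (row-cell b i<N)) ,
    subst₂ _<_ (sym (col-cell i a<M)) (sym (col-cell i b<M)) (kept-strictMono m a<b)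

  ◁-col : ∀ {j a b} → j < M → a < N → b < N → a < b → cell a j Cols.◁ cell b j
  ◁-col {j} {a} {b} j<M a<N b<N a<b =
    trans (col-cell a j<M) (sym (col-cell b j<M)) ,
    subst₂ _<_ (sym (row-cell j a<N)) (sym (row-cell j b<N)) (kept-strictMono n a<b)

  separated-cells : ∀ {i a j b k c} → i < N → a < M → j < N → b < M → k < N → c < M →
                    (cell j b ∈S X → X (cell i a) ≢ X (cell k c)) →
                    separated (entry grid i a) (entry grid j b) (entry grid k c) ≡ true
  separated-cells i<N a<M j<N b<M k<N c<M sep
    rewrite entry-grid i<N a<M | entry-grid j<N b<M | entry-grid k<N c<M = separated-intro sep

  grid-rows : rowsSeparated N M grid ≡ true
  grid-rows =
    allBelow-complete N _ λ {i} i<N → allBelow-complete M _ λ {a} a<M →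
    allBelow-complete M _ λ {b} b<M → allBelow-complete M _ λ {c} c<M → ⇒-intro λ abc →
    let a<b , b<c = ordered-sound a b c abc in
    separated-cells i<N a<M i<N b<M i<N c<M
      (Rows.separates X-dual (◁-row i<N a<M b<M a<b) (◁-row i<N b<M c<M b<c))

  grid-cols : colsSeparated N M grid ≡ true
  grid-cols =
    allBelow-complete M _ λ {j} j<M → allBelow-complete N _ λ {a} a<N →
    allBelow-complete N _ λ {b} b<N → allBelow-complete N _ λ {c} c<N → ⇒-intro λ abc →
    let a<b , b<c = ordered-sound a b c abc in
    separated-cells a<N j<M b<N j<M c<N j<M
      (Cols.separates X-dual (◁-col j<M a<N b<N a<b) (◁-col j<M b<N c<N b<c))

  module Corner {a a′ b b′ : ℕ} (a-end : End N (a , a′)) (b-end : End M (b , b′)) where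

    a<N = proj₁ (end-< (2≤#kept 2≤n) a-end)
    a′<N = proj₂ (end-< (2≤#kept 2≤n) a-end)
    b<M = proj₁ (end-< (2≤#kept 2≤m) b-end)
    b′<M = proj₂ (end-< (2≤#kept 2≤m) b-end)

    corner-neighbours : ∀ w → Adj (cell a b) w → w ≡ cell a b′ ⊎ w ≡ cell a′ b
    corner-neighbours w adj with m+n≡1 ∣ row (cell a b) - row w ∣ _ adj
    ... | inj₁ (Δr≡0 , Δc≡1) = inj₁ (cell-≡ a<N b′<M w
      (trans (sym (∣m-n∣≡0⇒m≡n Δr≡0)) (row-cell b a<N))
      (kept-end-neighbour m 2≤m b-end (col< w) (subst (λ c → ∣ c - col w ∣ ≡ 1) (col-cell a b<M) Δc≡1)))
    ... | inj₂ (Δr≡1 , Δc≡0) = inj₂ (cell-≡ a′<N b<M w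
      (kept-end-neighbour n 2≤n a-end (row< w) (subst (λ r → ∣ r - row w ∣ ≡ 1) (row-cell b a<N) Δr≡1))
      (trans (sym (∣m-n∣≡0⇒m≡n Δc≡0)) (col-cell a b<M)))

    saturated : cell a b′ ∈S X → cell a′ b ∈S X → Saturated X (cell a b)
    saturated ab′∈X a′b∈X w adj with corner-neighbours w adj
    ... | inj₁ refl = ab′∈X
    ... | inj₂ refl = a′b∈X

    member-case : cell a b′ ∈S X → cell a′ b ∈S X → cell a b ∈S X → ∀ {k l} → k < N → l < M →
                  (not (entry grid k l) ∨ (isCell k l a b ∨ (isCell k l a b′ ∨ isCell k l a′ b))) ≡ true
    member-case ab′∈X a′b∈X ab∈X {k} {l} k<N l<M rewrite entry-grid k<N l<M = ⇒-intro λ kl∈X →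
      case (saturated-member X-dual (saturated ab′∈X a′b∈X) ab∈X (cell k l) kl∈X)
      where
      is : ∀ {a b} → a < N → b < M → cell k l ≡ cell a b → isCell k l a b ≡ true
      is a<N b<M eq = let k≡a , l≡b = cell-injective k<N l<M a<N b<M eq in isCell-intro k≡a l≡b

      case : cell k l ≡ cell a b ⊎ Adj (cell a b) (cell k l) →
             (isCell k l a b ∨ (isCell k l a b′ ∨ isCell k l a′ b)) ≡ true
      case (inj₁ eq) = ∨-introˡ (is a<N b<M eq)
      case (inj₂ adj) with corner-neighbours (cell k l) adj
      ... | inj₁ eq = ∨-introʳ (isCell k l a b) (∨-introˡ (is a<N b′<M eq))
      ... | inj₂ eq = ∨-introʳ (isCell k l a b) (∨-introʳ (isCell k l a b′) (is a′<N b<M eq))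

    nonmember-case : cell a b′ ∈S X → cell a′ b ∈S X → cell a b ∉S X → ∀ {k l} → k < N → l < M →
                     (entry grid k l ∨ isCell k l a b) ≡ true
    nonmember-case ab′∈X a′b∈X ab∉X {k} {l} k<N l<M rewrite entry-grid k<N l<M with X (cell k l) in kl
    ... | true = refl
    ... | false = isCell-intro k≡a l≡b
      where
      k≡a×l≡b = cell-injective k<N l<M a<N b<M
                  (saturated-nonmember X-dual (saturated ab′∈X a′b∈X) ab∉X (cell k l) kl)
      k≡a = proj₁ k≡a×l≡b
      l≡b = proj₂ k≡a×l≡b

    corner-ok : cornerOK N M grid (a , a′) (b , b′) ≡ true
    corner-ok rewrite entry-grid a<N b′<M | entry-grid a′<N b<M = ⇒-intro λ both →
      let ab′∈X = ∧-conicalˡ _ _ both ; a′b∈X = ∧-conicalʳ (X (cell a b′)) _ both in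
      if-case ab′∈X a′b∈X
      where
      if-case : cell a b′ ∈S X → cell a′ b ∈S X →
        (if entry grid a b then onlyAt N M grid a a′ b b′ else exceptAt N M grid a b) ≡ true
      if-case ab′∈X a′b∈X rewrite entry-grid a<N b<M with X (cell a b) in ab
      ... | true = allBelow-complete N _ λ k<N → allBelow-complete M _ λ l<M →
        member-case ab′∈X a′b∈X ab k<N l<M
      ... | false = allBelow-complete N _ λ k<N → allBelow-complete M _ λ l<M →
        nonmember-case ab′∈X a′b∈X ab k<N l<M

  grid-admissible : admissible N M grid ≡ true
  grid-admissible = ∧-intro grid-rows (∧-intro grid-cols
    (forEachEnd-complete N _ λ a-end → forEachEnd-complete M _ λ b-end → Corner.corner-ok a-end b-end))

  card≤ : ∀ {B} → BoundedBy N M B ≡ true → card X ≤ B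
  card≤ bounded = ≤-trans card≤weight
    (bounded-sound bounded grid (length-tabulated X cell N M) (rows-tabulated X cell N M) grid-admissible)

dualMV-card≤ : ∀ {n m B} .{{_ : NonZero n}} .{{_ : NonZero m}} → 2 ≤ n → 2 ≤ m →
               BoundedBy (#kept n) (#kept m) B ≡ true → (X : VSubset n m) → IsDualMV X → card X ≤ B
dualMV-card≤ 2≤n 2≤m bounded X X-dual = Compression.card≤ 2≤n 2≤m X-dual bounded

-- Constructions

Point : Set
Point = ℕ × ℕ

coords : Vertex n m → Point
coords v = row v , col v

coords-vertex : ∀ {a b} (a<n : a < n) (b<m : b < m) → coords (vertex a b a<n b<m) ≡ (a , b)
coords-vertex a<n b<m = cong₂ _,_ (row-vertex a<n b<m) (col-vertex a<n b<m)

coords-injective : {u v : Vertex n m} → coords u ≡ coords v → u ≡ v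
coords-injective eq = vertex-≡ (cong proj₁ eq) (cong proj₂ eq)

allPairs-∈ : ∀ {A : Set} {R : A → A → Set} {xs : List A} → AllPairs R xs →
             ∀ {x y} → x ∈ xs → y ∈ xs → x ≡ y ⊎ R x y ⊎ R y x
allPairs-∈ (Rx ∷ _) (here refl) (here refl) = inj₁ refl
allPairs-∈ (Rx ∷ _) (here refl) (there y∈) = inj₂ (inj₁ (All.lookup Rx y∈))
allPairs-∈ (Rx ∷ _) (there x∈) (here refl) = inj₂ (inj₂ (All.lookup Rx x∈))
allPairs-∈ (_ ∷ R-xs) (there x∈) (there y∈) = allPairs-∈ R-xs x∈ y∈

InGrid : ℕ → ℕ → Point → Set
InGrid n m (r , c) = r < n × c < m

NotDiagonal : Point → Point → Set
NotDiagonal (r , c) (r′ , c′) = ∣ r - r′ ∣ ≡ 1 → ∣ c - c′ ∣ ≡ 1 → ⊥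

pointDist : Point → Point → ℕ
pointDist (r , c) (r′ , c′) = ∣ r - r′ ∣ + ∣ c - c′ ∣

-- Chosen makes non-membership refutable by unification; points decides membership and counts X.
module Construction {n m : ℕ} (Chosen : Point → Set) (points : List Point)
  (enumerates : ∀ {p} → Chosen p ⇔ p ∈ points) where

  open Equivalence

  X : VSubset n m
  X v = does (coords v ∈? points)

  ∈X⇒∈points : {v : Vertex n m} → v ∈S X → coords v ∈ points
  ∈X⇒∈points {v} v∈X = invert (subst (Reflects _) v∈X (proof (coords v ∈? points)))

  chosen⇒∈X : {v : Vertex n m} → Chosen (coords v) → v ∈S X
  chosen⇒∈X ch = dec-true (_ ∈? points) (to enumerates ch)

  ∈X⇒chosen : {v : Vertex n m} → v ∈S X → Chosen (coords v)
  ∈X⇒chosen v∈X = from enumerates (∈X⇒∈points v∈X)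

  unchosen⇒∉X : {v : Vertex n m} → ¬ Chosen (coords v) → v ∉S X
  unchosen⇒∉X ¬ch = dec-false (_ ∈? points) (¬ch ∘ from enumerates)

  card-X : Unique points → All (InGrid n m) points → card X ≡ length points
  card-X points-unique in-grid = ≤-antisym
    (begin
      card X                      ≡⟨ length-map coords chosen ⟨
      length (map coords chosen)
        ≤⟨ unique-⊆⇒length≤ (Unique.map⁺ coords-injective (filter⁺ (T? ∘ X) allVertices-unique))
                            image⊆points ⟩
      length points               ∎)
    (begin
      length points               ≤⟨ unique-⊆⇒length≤ points-unique points⊆image ⟩
      length (map coords chosen)  ≡⟨ length-map coords chosen ⟩
      card X                      ∎)
    where
    open ≤-Reasoning
    chosen = filter (T? ∘ X) (allVertices n m)

    image⊆points : ∀ {p} → p ∈ map coords chosen → p ∈ points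
    image⊆points p∈ with w , w∈ , refl ← ∈-map⁻ coords p∈ =
      ∈X⇒∈points (Equivalence.to T-≡ (proj₂ (∈-filter⁻ (T? ∘ X) {xs = allVertices n m} w∈)))

    points⊆image : ∀ {p} → p ∈ points → p ∈ map coords chosen
    points⊆image {r , c} p∈ with r<n , c<m ← All.lookup in-grid p∈ =
      subst (_∈ map coords chosen) coords-v≡p
        (∈-map⁺ coords (∈-filter⁺ (T? ∘ X) (∈-allVertices v) (Equivalence.from T-≡ v∈X)))
      where
      v = vertex r c r<n c<m
      coords-v≡p : coords v ≡ (r , c)
      coords-v≡p = coords-vertex r<n c<m
      v∈X : v ∈S X
      v∈X = dec-true (coords v ∈? points) (subst (_∈ points) (sym coords-v≡p) p∈)

  VisibleAt : Point → Point → Set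
  VisibleAt (r , c) (r′ , c′) =
    ∀ {u v : Vertex n m} → row u ≡ r → col u ≡ c → row v ≡ r′ → col v ≡ c′ → Visible X u v

  adjacent-visible : ∀ {p q} → pointDist p q ≡ 1 → VisibleAt p q
  adjacent-visible d refl refl refl refl = visible-adjacent X d

  chosen-visible : AllPairs VisibleAt points → ∀ u v → u ∈S X → v ∈S X → Visible X u v
  chosen-visible visible u v u∈X v∈X with allPairs-∈ visible (∈X⇒∈points u∈X) (∈X⇒∈points v∈X)
  ... | inj₁ eq = subst (Visible X u) (coords-injective eq) (visible-refl X u)
  ... | inj₂ (inj₁ u-v) = u-v refl refl refl refl
  ... | inj₂ (inj₂ v-u) = visible-sym X (v-u refl refl refl refl)

  RowClosed ColClosed : Set
  RowClosed = ∀ {r c c₁ c₂} → Chosen (r , c) → c₁ < c → c < c₂ → c₂ < m → Chosen (r , c₁) ⊎ Chosen (r , c₂)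
  ColClosed = ∀ {r c r₁ r₂} → Chosen (r , c) → r₁ < r → r < r₂ → r₂ < n → Chosen (r₁ , c) ⊎ Chosen (r₂ , c)

  module ConvexComplement (row-closed : RowClosed) (col-closed : ColClosed)
    (not-diagonal : AllPairs NotDiagonal points) where

    private
      chosen-∉ : {v : Vertex n m} {r c : ℕ} → Chosen (r , c) → row v ≡ r → col v ≡ c → v ∉S X → ⊥
      chosen-∉ ch refl refl v∉X = ∈S-∉S {X = X} (chosen⇒∈X ch) v∉X

    row-convex : ∀ p q r → row p ≡ row q → row q ≡ row r → col p < col q → col q < col r →
                 p ∉S X → r ∉S X → q ∉S X
    row-convex p q r p≡q q≡r p<q q<r p∉X r∉X with X q in q∈X
    ... | false = refl
    ... | true with row-closed (∈X⇒chosen q∈X) p<q q<r (col< r)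
    ... | inj₁ ch = ⊥-elim (chosen-∉ ch p≡q refl p∉X)
    ... | inj₂ ch = ⊥-elim (chosen-∉ ch (sym q≡r) refl r∉X)

    col-convex : ∀ p q r → col p ≡ col q → col q ≡ col r → row p < row q → row q < row r →
                 p ∉S X → r ∉S X → q ∉S X
    col-convex p q r p≡q q≡r p<q q<r p∉X r∉X with X q in q∈X
    ... | false = refl
    ... | true with col-closed (∈X⇒chosen q∈X) p<q q<r (row< r)
    ... | inj₁ ch = ⊥-elim (chosen-∉ ch refl p≡q p∉X)
    ... | inj₂ ch = ⊥-elim (chosen-∉ ch refl (sym q≡r) r∉X)

    no-diagonal : ∀ p q → ∣ row p - row q ∣ ≡ 1 → ∣ col p - col q ∣ ≡ 1 → p ∉S X ⊎ q ∉S X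
    no-diagonal p q dr dc with X p in p∈X | X q in q∈X
    ... | false | _ = inj₁ refl
    ... | true | false = inj₂ refl
    ... | true | true with allPairs-∈ not-diagonal (∈X⇒∈points p∈X) (∈X⇒∈points q∈X)
    ... | inj₁ eq = ⊥-elim (0≢1+n (trans (sym (∣n-n∣≡0 (row p)))
                                         (trans (cong (∣ row p -_∣) (cong proj₁ eq)) dr)))
    ... | inj₂ (inj₁ p-q) = ⊥-elim (p-q dr dc)
    ... | inj₂ (inj₂ q-p) =
      ⊥-elim (q-p (trans (∣-∣-comm (row q) (row p)) dr) (trans (∣-∣-comm (col q) (col p)) dc))

    open FreeGeodesics X row-convex col-convex no-diagonal public

    detour-visible : ∀ {p q} p′ q′ → InGrid n m p′ → InGrid n m q′ → ¬ Chosen p′ → ¬ Chosen q′ →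
                     pointDist p p′ ≡ 1 → pointDist q′ q ≡ 1 → 2 + pointDist p′ q′ ≡ pointDist p q → VisibleAt p q
    detour-visible (r′ , c′) (r″ , c″) (r′<n , c′<m) (r″<n , c″<m) ¬ch′ ¬ch″ d′ d″ d {u} {v} refl refl refl refl =
      visible-detour u u′ v″ v
        (trans (dist-vertexʳ u r′<n c′<m) d′) (trans (dist-vertexˡ r″<n c″<m v) d″)
        (unchosen⇒∉X (¬ch′ ∘ subst Chosen (coords-vertex r′<n c′<m)))
        (unchosen⇒∉X (¬ch″ ∘ subst Chosen (coords-vertex r″<n c″<m)))
        (trans (cong (2 +_) (trans (dist-vertexˡ r′<n c′<m v″) (cong₂ (λ x y → ∣ r′ - x ∣ + ∣ c′ - y ∣)
                                                                      (row-vertex r″<n c″<m)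
                                                                      (col-vertex r″<n c″<m)))) d)
      where
      u′ = vertex r′ c′ r′<n c′<m
      v″ = vertex r″ c″ r″<n c″<m

    dual : AllPairs VisibleAt points → IsDualMV X
    dual visible = chosen-visible visible , λ u v → free-visible

step-right : ∀ r c → pointDist (r , c) (r , suc c) ≡ 1
step-right r c = cong₂ _+_ (∣n-n∣≡0 r) (∣n-1+n∣≡1 c)

step-down : ∀ r c → pointDist (r , c) (suc r , c) ≡ 1
step-down r c = cong₂ _+_ (∣n-1+n∣≡1 r) (∣n-n∣≡0 c)

step-up : ∀ r c → pointDist (suc r , c) (r , c) ≡ 1
step-up r c = cong₂ _+_ (∣1+n-n∣≡1 r) (∣n-n∣≡0 c)

no-between : ∀ {k x} → k < x → x < suc k → ⊥
no-between k<x x<1+k = ≤⇒≯ (≤-pred x<1+k) k<x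

between⇒suc : ∀ {k x} → k < x → x < 2 + k → x ≡ suc k
between⇒suc k<x x<2+k = ≤-antisym (≤-pred x<2+k) k<x

2+[m+n]≡m+[2+n] : ∀ x y → 2 + (x + y) ≡ x + (2 + y)
2+[m+n]≡m+[2+n] x y = sym (trans (+-suc x (suc y)) (cong suc (+-suc x y)))

module Five (a b : ℕ) where

  data Chosen : Point → Set where
    top₀ : Chosen (0 , 0)
    top₁ : Chosen (0 , 1)
    bottom₀ : Chosen (3 + a , 0)
    bottomₘ : Chosen (3 + a , 2 + b)
    above-bottomₘ : Chosen (2 + a , 2 + b)

  points : List Point
  points = (0 , 0) ∷ (0 , 1) ∷ (3 + a , 0) ∷ (3 + a , 2 + b) ∷ (2 + a , 2 + b) ∷ []

  enumerates : ∀ {p} → Chosen p ⇔ p ∈ points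
  enumerates = mk⇔ to from
    where
    to : ∀ {p} → Chosen p → p ∈ points
    to top₀ = here refl
    to top₁ = there (here refl)
    to bottom₀ = there (there (here refl))
    to bottomₘ = there (there (there (here refl)))
    to above-bottomₘ = there (there (there (there (here refl))))
    from : ∀ {p} → p ∈ points → Chosen p
    from (here refl) = top₀
    from (there (here refl)) = top₁
    from (there (there (here refl))) = bottom₀
    from (there (there (there (here refl)))) = bottomₘ
    from (there (there (there (there (here refl))))) = above-bottomₘ

  open Construction {4 + a} {3 + b} Chosen points enumerates public

  row-closed : RowClosed
  row-closed top₁ (s≤s z≤n) _ _ = inj₁ top₀
  row-closed bottomₘ _ c<c₂ c₂<m = ⊥-elim (no-between c<c₂ c₂<m)
  row-closed above-bottomₘ _ c<c₂ c₂<m = ⊥-elim (no-between c<c₂ c₂<m)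

  col-closed : ColClosed
  col-closed bottom₀ _ r<r₂ r₂<n = ⊥-elim (no-between r<r₂ r₂<n)
  col-closed bottomₘ _ r<r₂ r₂<n = ⊥-elim (no-between r<r₂ r₂<n)
  col-closed above-bottomₘ _ r<r₂ r₂<n with refl ← between⇒suc r<r₂ r₂<n = inj₂ bottomₘ

  not-diagonal : AllPairs NotDiagonal points
  not-diagonal =
    ((λ ()) ∷ (λ ()) ∷ (λ ()) ∷ (λ ()) ∷ []) ∷
    ((λ ()) ∷ (λ ()) ∷ (λ ()) ∷ []) ∷
    ((λ _ ()) ∷ (λ _ ()) ∷ []) ∷
    ((λ _ d → 0≢1+n (trans (sym (∣n-n∣≡0 b)) d)) ∷ []) ∷
    [] ∷ []

  open ConvexComplement row-closed col-closed not-diagonal using (detour-visible)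

  private
    0<n : 0 < 4 + a
    0<n = s≤s z≤n
    1<n : 1 < 4 + a
    1<n = s≤s (s≤s z≤n)
    2+a<n : 2 + a < 4 + a
    2+a<n = s≤s (s≤s (s≤s (n≤1+n a)))
    0<m : 0 < 3 + b
    0<m = s≤s z≤n
    1<m : 1 < 3 + b
    1<m = s≤s (s≤s z≤n)
    1+b<m : 1 + b < 3 + b
    1+b<m = s≤s (s≤s (n≤1+n b))

  top₀↔top₁ : VisibleAt (0 , 0) (0 , 1)
  top₀↔top₁ = adjacent-visible refl

  top₀↔bottom₀ : VisibleAt (0 , 0) (3 + a , 0)
  top₀↔bottom₀ = detour-visible (1 , 0) (2 + a , 0) (1<n , 0<m) (2+a<n , 0<m) (λ ()) (λ ())
    refl (step-down (2 + a) 0) refl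

  top₀↔bottomₘ : VisibleAt (0 , 0) (3 + a , 2 + b)
  top₀↔bottomₘ = detour-visible (1 , 0) (3 + a , 1 + b) (1<n , 0<m) (≤-refl , 1+b<m) (λ ()) (λ ())
    refl (step-right (3 + a) (1 + b)) (cong (3 +_) (sym (+-suc a (suc b))))

  top₀↔above-bottomₘ : VisibleAt (0 , 0) (2 + a , 2 + b)
  top₀↔above-bottomₘ = detour-visible (1 , 0) (2 + a , 1 + b) (1<n , 0<m) (2+a<n , 1+b<m) (λ ()) (λ ())
    refl (step-right (2 + a) (1 + b)) (cong (2 +_) (sym (+-suc a (suc b))))

  top₁↔bottom₀ : VisibleAt (0 , 1) (3 + a , 0)
  top₁↔bottom₀ = detour-visible (1 , 1) (2 + a , 0) (1<n , 1<m) (2+a<n , 0<m) (λ ()) (λ ())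
    refl (step-down (2 + a) 0) refl

  top₁↔bottomₘ : VisibleAt (0 , 1) (3 + a , 2 + b)
  top₁↔bottomₘ = detour-visible (1 , 1) (3 + a , 1 + b) (1<n , 1<m) (≤-refl , 1+b<m) (λ ()) (λ ())
    refl (step-right (3 + a) (1 + b)) (cong (3 +_) (sym (+-suc a b)))

  top₁↔above-bottomₘ : VisibleAt (0 , 1) (2 + a , 2 + b)
  top₁↔above-bottomₘ = detour-visible (1 , 1) (2 + a , 1 + b) (1<n , 1<m) (2+a<n , 1+b<m) (λ ()) (λ ())
    refl (step-right (2 + a) (1 + b)) (cong (2 +_) (sym (+-suc a b)))

  bottom₀↔bottomₘ : VisibleAt (3 + a , 0) (3 + a , 2 + b)
  bottom₀↔bottomₘ = detour-visible (3 + a , 1) (3 + a , 1 + b) (≤-refl , 1<m) (≤-refl , 1+b<m) (λ ()) (λ ())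
    (step-right (3 + a) 0) (step-right (3 + a) (1 + b)) (2+[m+n]≡m+[2+n] ∣ a - a ∣ b)

  bottom₀↔above-bottomₘ : VisibleAt (3 + a , 0) (2 + a , 2 + b)
  bottom₀↔above-bottomₘ = detour-visible (3 + a , 1) (2 + a , 1 + b) (≤-refl , 1<m) (2+a<n , 1+b<m) (λ ()) (λ ())
    (step-right (3 + a) 0) (step-right (2 + a) (1 + b)) (2+[m+n]≡m+[2+n] ∣ suc a - a ∣ b)

  bottomₘ↔above-bottomₘ : VisibleAt (3 + a , 2 + b) (2 + a , 2 + b)
  bottomₘ↔above-bottomₘ = adjacent-visible (step-up (2 + a) (2 + b))

  dual : IsDualMV X
  dual = ConvexComplement.dual row-closed col-closed not-diagonal
    ((top₀↔top₁ ∷ top₀↔bottom₀ ∷ top₀↔bottomₘ ∷ top₀↔above-bottomₘ ∷ []) ∷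
     (top₁↔bottom₀ ∷ top₁↔bottomₘ ∷ top₁↔above-bottomₘ ∷ []) ∷
     (bottom₀↔bottomₘ ∷ bottom₀↔above-bottomₘ ∷ []) ∷
     (bottomₘ↔above-bottomₘ ∷ []) ∷
     [] ∷ [])

  card≡5 : card X ≡ 5
  card≡5 = card-X
    (((λ ()) ∷ (λ ()) ∷ (λ ()) ∷ (λ ()) ∷ []) ∷ ((λ ()) ∷ (λ ()) ∷ (λ ()) ∷ []) ∷
     ((λ ()) ∷ (λ ()) ∷ []) ∷ ((λ ()) ∷ []) ∷ [] ∷ [])
    ((0<n , 0<m) ∷ (0<n , 1<m) ∷ (≤-refl , 0<m) ∷ (≤-refl , ≤-refl) ∷ (2+a<n , ≤-refl) ∷ [])

module Four (a b : ℕ) where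

  data Chosen : Point → Set where
    top₀ : Chosen (0 , 0)
    top₁ : Chosen (0 , 1)
    bottom₀ : Chosen (2 + a , 0)
    bottom₁ : Chosen (2 + a , 1)

  points : List Point
  points = (0 , 0) ∷ (0 , 1) ∷ (2 + a , 0) ∷ (2 + a , 1) ∷ []

  enumerates : ∀ {p} → Chosen p ⇔ p ∈ points
  enumerates = mk⇔ to from
    where
    to : ∀ {p} → Chosen p → p ∈ points
    to top₀ = here refl
    to top₁ = there (here refl)
    to bottom₀ = there (there (here refl))
    to bottom₁ = there (there (there (here refl)))
    from : ∀ {p} → p ∈ points → Chosen p
    from (here refl) = top₀
    from (there (here refl)) = top₁
    from (there (there (here refl))) = bottom₀
    from (there (there (there (here refl)))) = bottom₁

  open Construction {3 + a} {2 + b} Chosen points enumerates public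

  row-closed : RowClosed
  row-closed top₁ (s≤s z≤n) _ _ = inj₁ top₀
  row-closed bottom₁ (s≤s z≤n) _ _ = inj₁ bottom₀

  col-closed : ColClosed
  col-closed bottom₀ _ r<r₂ r₂<n = ⊥-elim (no-between r<r₂ r₂<n)
  col-closed bottom₁ _ r<r₂ r₂<n = ⊥-elim (no-between r<r₂ r₂<n)

  not-diagonal : AllPairs NotDiagonal points
  not-diagonal =
    ((λ ()) ∷ (λ ()) ∷ (λ ()) ∷ []) ∷
    ((λ ()) ∷ (λ ()) ∷ []) ∷
    ((λ d _ → 0≢1+n (trans (sym (∣n-n∣≡0 a)) d)) ∷ []) ∷
    [] ∷ []

  open ConvexComplement row-closed col-closed not-diagonal using (detour-visible)

  private
    0<n : 0 < 3 + a
    0<n = s≤s z≤n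
    1<n : 1 < 3 + a
    1<n = s≤s (s≤s z≤n)
    1+a<n : 1 + a < 3 + a
    1+a<n = s≤s (s≤s (n≤1+n a))
    0<m : 0 < 2 + b
    0<m = s≤s z≤n
    1<m : 1 < 2 + b
    1<m = s≤s (s≤s z≤n)

  top₀↔top₁ : VisibleAt (0 , 0) (0 , 1)
  top₀↔top₁ = adjacent-visible refl

  top₀↔bottom₀ : VisibleAt (0 , 0) (2 + a , 0)
  top₀↔bottom₀ = detour-visible (1 , 0) (1 + a , 0) (1<n , 0<m) (1+a<n , 0<m) (λ ()) (λ ())
    refl (step-down (1 + a) 0) refl

  top₀↔bottom₁ : VisibleAt (0 , 0) (2 + a , 1)
  top₀↔bottom₁ = detour-visible (1 , 0) (1 + a , 1) (1<n , 0<m) (1+a<n , 1<m) (λ ()) (λ ())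
    refl (step-down (1 + a) 1) refl

  top₁↔bottom₀ : VisibleAt (0 , 1) (2 + a , 0)
  top₁↔bottom₀ = detour-visible (1 , 1) (1 + a , 0) (1<n , 1<m) (1+a<n , 0<m) (λ ()) (λ ())
    refl (step-down (1 + a) 0) refl

  top₁↔bottom₁ : VisibleAt (0 , 1) (2 + a , 1)
  top₁↔bottom₁ = detour-visible (1 , 1) (1 + a , 1) (1<n , 1<m) (1+a<n , 1<m) (λ ()) (λ ())
    refl (step-down (1 + a) 1) refl

  bottom₀↔bottom₁ : VisibleAt (2 + a , 0) (2 + a , 1)
  bottom₀↔bottom₁ = adjacent-visible (step-right (2 + a) 0)

  dual : IsDualMV X
  dual = ConvexComplement.dual row-closed col-closed not-diagonal
    ((top₀↔top₁ ∷ top₀↔bottom₀ ∷ top₀↔bottom₁ ∷ []) ∷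
     (top₁↔bottom₀ ∷ top₁↔bottom₁ ∷ []) ∷
     (bottom₀↔bottom₁ ∷ []) ∷
     [] ∷ [])

  card≡4 : card X ≡ 4
  card≡4 = card-X
    (((λ ()) ∷ (λ ()) ∷ (λ ()) ∷ []) ∷ ((λ ()) ∷ (λ ()) ∷ []) ∷ ((λ ()) ∷ []) ∷ [] ∷ [])
    ((0<n , 0<m) ∷ (0<n , 1<m) ∷ (≤-refl , 0<m) ∷ (≤-refl , 1<m) ∷ [])

module TwoByTwo where

  pattern ₀ = Fin.zero
  pattern ₁ = Fin.suc Fin.zero

  X : VSubset 2 2
  X (₁ , ₁) = false
  X _ = true

  visible-₀₁-₁₀ : Visible X (₀ , ₁) (₁ , ₀)
  visible-₀₁-₁₀ = visible-geodesic X (_∷_ {w = ₁ , ₁} refl (refl ∷ [])) refl λ where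
    _ (here refl) _ → inj₁ refl
    _ (there (here refl)) ()
    _ (there (there (here refl))) _ → inj₂ refl

  visible-X : ∀ u v → u ∈S X → v ∈S X → Visible X u v
  visible-X (₁ , ₁) _ () _
  visible-X _ (₁ , ₁) _ ()
  visible-X (₀ , ₀) (₀ , ₀) _ _ = visible-refl X _
  visible-X (₀ , ₀) (₀ , ₁) _ _ = visible-adjacent X refl
  visible-X (₀ , ₀) (₁ , ₀) _ _ = visible-adjacent X refl
  visible-X (₀ , ₁) (₀ , ₀) _ _ = visible-adjacent X refl
  visible-X (₀ , ₁) (₀ , ₁) _ _ = visible-refl X _
  visible-X (₀ , ₁) (₁ , ₀) _ _ = visible-₀₁-₁₀
  visible-X (₁ , ₀) (₀ , ₀) _ _ = visible-adjacent X refl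
  visible-X (₁ , ₀) (₀ , ₁) _ _ = visible-sym X visible-₀₁-₁₀
  visible-X (₁ , ₀) (₁ , ₀) _ _ = visible-refl X _

  visible-free : ∀ u v → u ∉S X → v ∉S X → Visible X u v
  visible-free (₁ , ₁) (₁ , ₁) _ _ = visible-refl X _

  dual : IsDualMV X
  dual = visible-X , visible-free

  card≡3 : card X ≡ 3
  card≡3 = refl

bounded-2×2 : BoundedBy 2 2 3 ≡ true
bounded-2×2 = refl

bounded-n×2 : ∀ a → BoundedBy (#kept (3 + a)) 2 4 ≡ true
bounded-n×2 zero = refl
bounded-n×2 (suc a) = refl

bounded-3×3 : BoundedBy 3 3 4 ≡ true
bounded-3×3 = refl

bounded-large : ∀ b → BoundedBy 4 (#kept (3 + b)) 5 ≡ true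
bounded-large zero = refl
bounded-large (suc b) = refl

μ-2×2 : MuD≡ 2 2 3
μ-2×2 = (TwoByTwo.X , TwoByTwo.dual , TwoByTwo.card≡3) , dualMV-card≤ ≤-refl ≤-refl bounded-2×2

μ-n×2 : ∀ a → MuD≡ (3 + a) 2 4
μ-n×2 a = (Four.X a 0 , Four.dual a 0 , Four.card≡4 a 0) ,
          dualMV-card≤ (s≤s (s≤s z≤n)) ≤-refl (bounded-n×2 a)

μ-3×3 : MuD≡ 3 3 4
μ-3×3 = (Four.X 0 1 , Four.dual 0 1 , Four.card≡4 0 1) ,
        dualMV-card≤ (s≤s (s≤s z≤n)) (s≤s (s≤s z≤n)) bounded-3×3

μ-large : ∀ a b → MuD≡ (4 + a) (3 + b) 5
μ-large a b = (Five.X a b , Five.dual a b , Five.card≡5 a b) ,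
              dualMV-card≤ (s≤s (s≤s z≤n)) (s≤s (s≤s z≤n)) (bounded-large b)

data Shape : ℕ → ℕ → Set where
  2×2 : Shape 2 2
  n×2 : ∀ a → Shape (3 + a) 2
  3×3 : Shape 3 3
  large : ∀ a b → Shape (4 + a) (3 + b)

shape : ∀ {n m} → 2 ≤ m → m ≤ n → Shape n m
shape (s≤s (s≤s _)) (s≤s (s≤s m≤n)) = shape′ m≤n
  where
  shape′ : ∀ {n m} → m ≤ n → Shape (2 + n) (2 + m)
  shape′ {zero} {zero} _ = 2×2
  shape′ {suc a} {zero} _ = n×2 a
  shape′ {suc zero} {suc zero} _ = 3×3
  shape′ {suc (suc a)} {suc b} _ = large a b
  shape′ {suc zero} {suc (suc b)} (s≤s ())

theorem4p4 : ∀ (n m : ℕ) → 2 ≤ m → m ≤ n →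
    ((n ≡ 2 × m ≡ 2) → MuD≡ n m 3) ×
    (((n ≡ 3 × m ≡ 3) ⊎ (n ≥ 3 × m ≡ 2)) → MuD≡ n m 4) ×
    (¬ (n ≡ 2 × m ≡ 2) → ¬ (n ≡ 3 × m ≡ 3) → ¬ (n ≥ 3 × m ≡ 2) → MuD≡ n m 5)
theorem4p4 n m 2≤m m≤n with shape 2≤m m≤n
... | 2×2 = (λ _ → μ-2×2) ,
            (λ { (inj₁ (() , _)) ; (inj₂ (s≤s (s≤s ()) , _)) }) ,
            (λ ¬2×2 _ _ → ⊥-elim (¬2×2 (refl , refl)))
... | n×2 a = (λ { (() , _) }) ,
              (λ _ → μ-n×2 a) ,
              (λ _ _ ¬n×2 → ⊥-elim (¬n×2 (s≤s (s≤s (s≤s z≤n)) , refl)))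
... | 3×3 = (λ { (() , _) }) ,
            (λ _ → μ-3×3) ,
            (λ _ ¬3×3 _ → ⊥-elim (¬3×3 (refl , refl)))
... | large a b = (λ { (() , _) }) ,
                  (λ { (inj₁ (() , _)) ; (inj₂ (_ , ())) }) ,
                  (λ _ _ _ → μ-large a b)
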